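{- Let $\Delta$ be a simplicial complex on the vertex set $[n]$ which, for some field $\mathbb{k}$, is a vertex minimal $h$-cycle, i.e. for every $T\subseteq[n]$ one has $\widetilde{H}_h(\Delta|_T;\mathbb{k})\neq 0$ if and only if $T=[n]$. Let $G$ be the 1-skeleton of $\Delta$ and let $s$ be the maximum degree of the minimal monomial generators of the Stanley–Reisner ideal $I_\Delta$. Then $G$ is $\left\lceil \frac{sh}{s-1}\right\rceil$-connected.
   Context: $\Delta$ is a simplicial complex whose vertices are the elements of $[n]=\{1,\ldots,n\}$ (each $\{i\}$ is a face). For $T\subseteq[n]$, $\Delta|_T$ is the subcomplex of all faces of $\Delta$ contained in $T$; $\widetilde{H}_i(\,\cdot\,;\mathbb{k})$ is reduced simplicial homology over $\mathbb{k}$. The Stanley–Reisner ideal $I_\Delta\subseteq \mathbb{k}[x_1,\ldots,x_n]$ is generated by the squarefree monomials $x_{i_1}\cdots x_{i_t}$ with $\{i_1,\ldots,i_t\}\notin\Delta$. The 1-skeleton $G$ of $\Delta$ is the graph whose vertices are the vertices of $\Delta$ and whose edges are the 1-dimensional faces of $\Delta$. A graph is $m$-connected if it has more than $m$ vertices and deleting any set of fewer than $m$ vertices (together with their incident edges) leaves a connected graph. -}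

module Defs where

open import Level using (Level; suc; _⊔_; 0ℓ)
import Data.Nat as ℕ
open ℕ using (ℕ; zero; _<_; _<ᵇ_)
open import Data.Nat.DivMod using (_/_)
open import Data.Bool using (Bool; true; false; if_then_else_; T)
open import Data.Fin using (Fin; toℕ)
open import Data.Fin.Subset using (Subset; _∈_; _∉_; _⊆_; _∪_; _∩_; ⁅_⁆; ∣_∣; ⊤)
open import Data.Vec using (Vec; tabulate; _[_]≔_; lookup)
open import Data.List using (List; map)
open import Data.List using (allFin) renaming (foldr to lfoldr)
open import Data.Product using (Σ; _×_; ∃)
open import Relation.Nullary using (¬_)
open import Relation.Binary.PropositionalEquality using (_≡_)
open import Algebra.Bundles using (CommutativeRing)

record Field (c ℓ : Level) : Set (suc (c ⊔ ℓ)) where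
  field
    commutativeRing : CommutativeRing c ℓ
  open CommutativeRing commutativeRing public
  field
    0≉1     : ¬ (0# ≈ 1#)
    inverse : ∀ x → ¬ (x ≈ 0#) → Σ Carrier (λ y → (x * y) ≈ 1#)

record SimplicialComplex (n : ℕ) : Set where
  field
    isFace   : Subset n → Bool
    downward : ∀ σ τ → τ ⊆ σ → T (isFace σ) → T (isFace τ)
    vertices : ∀ i → T (isFace ⁅ i ⁆)

open SimplicialComplex public

Face : ∀ {n} → SimplicialComplex n → Subset n → Set
Face Δ σ = T (isFace Δ σ)

FaceOfRestriction : ∀ {n} → SimplicialComplex n → Subset n → Subset n → Set
FaceOfRestriction Δ W σ = Face Δ σ × σ ⊆ W

module Homology {c ℓ : Level} (K : Field c ℓ) where
  open Field K

  -- a "chain" is a function on all subsets; it is an i-chain of Δ|_W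
  -- if it vanishes outside the faces of Δ|_W with exactly i+1 vertices
  -- (the size is passed as k = i + 1, so k = 0 is the empty face,
  -- i.e. the augmented (reduced) complex).
  Chain : ℕ → Set c
  Chain n = Subset n → Carrier

  IsChainOfSize : ∀ {n} → SimplicialComplex n → Subset n → ℕ → Chain n → Set ℓ
  IsChainOfSize Δ W k z =
    ∀ σ → ¬ (FaceOfRestriction Δ W σ × ∣ σ ∣ ≡ k) → z σ ≈ 0#

  sumFin : ∀ {n} → (Fin n → Carrier) → Carrier
  sumFin {n} f = lfoldr _+_ 0# (map f (allFin n))

  sign : ℕ → Carrier
  sign zero        = 1#
  sign (ℕ.suc m)   = - sign m

  below : ∀ {n} → Fin n → Subset n
  below v = tabulate (λ u → toℕ u <ᵇ toℕ v)

  -- simplicial boundary: (∂ z)(τ) = Σ_{v ∉ τ} (-1)^{#{u ∈ τ : u < v}} z(τ ∪ {v}),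
  -- the sign being (-1)^(position of v in the ordered face τ ∪ {v}).
  ∂ : ∀ {n} → Chain n → Chain n
  ∂ z τ = sumFin (λ v → if lookup τ v then 0#
                        else (sign ∣ τ ∩ below v ∣ * z (τ ∪ ⁅ v ⁆)))

  -- \tilde H_i(Δ|_W ; K) ≠ 0 : some i-cycle is not an i-boundary
  -- (sizes: i-chains have i+1 vertices, (i+1)-chains have i+2).
  ReducedHomologyNonzero : ∀ {n} → SimplicialComplex n → Subset n → ℕ → Set (c ⊔ ℓ)
  ReducedHomologyNonzero Δ W i =
    Σ (Chain _) λ z →
      IsChainOfSize Δ W (ℕ.suc i) z ×
      (∀ τ → ∂ z τ ≈ 0#) ×
      ¬ (Σ (Chain _) λ b → IsChainOfSize Δ W (ℕ.suc (ℕ.suc i)) b × (∀ σ → ∂ b σ ≈ z σ))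

IsVertexMinimalCycle : ∀ {c ℓ n} → Field c ℓ → SimplicialComplex n → ℕ → Set (c ⊔ ℓ)
IsVertexMinimalCycle K Δ h =
  ∀ W → (Homology.ReducedHomologyNonzero K Δ W h → W ≡ ⊤) × (W ≡ ⊤ → Homology.ReducedHomologyNonzero K Δ W h)

-- Minimal non-faces = supports of the minimal monomial generators of I_Δ.

IsMinimalNonFace : ∀ {n} → SimplicialComplex n → Subset n → Set
IsMinimalNonFace Δ σ = ¬ Face Δ σ × (∀ i → i ∈ σ → Face Δ (σ [ i ]≔ false))

-- s is the maximum degree of a minimal monomial generator of I_Δ
-- (the generator x_σ = ∏_{i∈σ} x_i has degree ∣σ∣).
IsMaxGeneratorDegree : ∀ {n} → SimplicialComplex n → ℕ → Set
IsMaxGeneratorDegree Δ s =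
  Σ (Subset _) (λ σ → IsMinimalNonFace Δ σ × ∣ σ ∣ ≡ s) ×
  (∀ σ → IsMinimalNonFace Δ σ → ∣ σ ∣ ℕ.≤ s)

Adjacent : ∀ {n} → SimplicialComplex n → Fin n → Fin n → Set
Adjacent Δ u v = ¬ (u ≡ v) × Face Δ (⁅ u ⁆ ∪ ⁅ v ⁆)

data WalkAvoiding {n} (Δ : SimplicialComplex n) (S : Subset n) : Fin n → Fin n → Set where
  stop : ∀ {u} → WalkAvoiding Δ S u u
  step : ∀ {u v w} → Adjacent Δ u v → v ∉ S → WalkAvoiding Δ S v w → WalkAvoiding Δ S u w

IsMConnectedSkeleton : ∀ {n} → SimplicialComplex n → ℕ → Set
IsMConnectedSkeleton {n} Δ m =
  m < n × (∀ S → ∣ S ∣ < m → ∀ u v → u ∉ S → v ∉ S → WalkAvoiding Δ S u v)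

-- ⌈ a / b ⌉ (value 0 when b = 0, a case that never arises here)
⌈_/_⌉ : ℕ → ℕ → ℕ
⌈ a / zero ⌉    = 0
⌈ a / ℕ.suc b ⌉ = (a ℕ.+ b) / ℕ.suc b

-- First, a counting bound: if every minimal non-face of Γ has at most s
-- vertices and H̃_{k-1}(Γ) ≠ 0, then s·k ≤ (s−1)·|V(Γ)|.  It is proved by induction on the number
-- of vertices, removing a vertex x of a small non-face ρ: either the deletion of x still carries
-- the homology class, or (Mayer–Vietoris) the link of x carries one in degree k−2, and ρ − x is a
-- non-face of the link.  Second, separation: if S separates u from v in the 1-skeleton, cutting
-- the fundamental h-cycle of Δ along the component of u yields a nonzero class of H̃_{h-1}(Δ|_S),
-- because Δ is vertex minimal.  The bound for Δ itself (k = h + 1) gives n > ⌈sh/(s−1)⌉, and the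
-- bound for Δ|_S (k = h) gives |S| ≥ ⌈sh/(s−1)⌉.
module Submission where

open import Level using (Level)
open import Algebra.Bundles using (Ring)
open import Data.Nat using (ℕ; suc; _≤_)
open import Data.Fin using (Fin)
open import Data.Fin.Subset using (Subset; _∈_; _∉_; ∣_∣)
open import Defs

module SubsetLemmas where
  open import Data.Nat using (ℕ; zero; suc; _+_; _<_; _<ᵇ_)
  open import Data.Nat.Properties using (+-comm; ≤-trans; ≤-reflexive)
  open import Data.Bool using (Bool; true; false)
  open import Data.Fin using (Fin; zero; suc; toℕ)
  open import Data.Fin.Properties using (_≟_)
  open import Data.Fin.Subset
  open import Data.Fin.Subset.Properties
  open import Data.Vec using ([]; _∷_; here; there; lookup; _[_]≔_)
  open import Data.Vec.Properties using ([]=⇒lookup; lookup⇒[]=; lookup∘update; lookup∘update′)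
  open import Data.Product using (_,_)
  open import Data.Sum using (inj₁; inj₂)
  open import Relation.Nullary using (yes; no)
  open import Relation.Nullary.Negation using (contradiction)
  open import Relation.Binary.PropositionalEquality

  private variable
    n : ℕ
    x y : Fin n
    p q σ τ V : Subset n

  indicator : Bool → ℕ
  indicator true  = 1
  indicator false = 0

  ∉⇒lookup≡false : x ∉ p → lookup p x ≡ false
  ∉⇒lookup≡false {x = x} {p} x∉p with lookup p x in eq
  ... | true  = contradiction (lookup⇒[]= x p eq) x∉p
  ... | false = refl

  lookup≡false⇒∉ : lookup p x ≡ false → x ∉ p
  lookup≡false⇒∉ eq x∈p with trans (sym eq) ([]=⇒lookup x∈p)
  ... | ()

  x∈p⇒⁅x⁆⊆p : x ∈ p → ⁅ x ⁆ ⊆ p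
  x∈p⇒⁅x⁆⊆p {x = x} x∈p y∈ = subst (_∈ _) (sym (x∈⁅y⁆⇒x≡y x y∈)) x∈p

  indicator-<ᵇ : ∀ (x y : Fin n) → x ≢ y → indicator (toℕ x <ᵇ toℕ y) + indicator (toℕ y <ᵇ toℕ x) ≡ 1
  indicator-<ᵇ zero    zero    x≢y = contradiction refl x≢y
  indicator-<ᵇ zero    (suc y) _   = refl
  indicator-<ᵇ (suc x) zero    _   = refl
  indicator-<ᵇ (suc x) (suc y) x≢y = indicator-<ᵇ x y (λ x≡y → x≢y (cong suc x≡y))

  x∈p∪⁅x⁆ : ∀ (p : Subset n) x → x ∈ p ∪ ⁅ x ⁆
  x∈p∪⁅x⁆ p x = q⊆p∪q p ⁅ x ⁆ (x∈⁅x⁆ x)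

  ∈-insert⁻ : y ∈ p ∪ ⁅ x ⁆ → y ≢ x → y ∈ p
  ∈-insert⁻ {p = p} {x = x} y∈ y≢x with x∈p∪q⁻ p ⁅ x ⁆ y∈
  ... | inj₁ y∈p = y∈p
  ... | inj₂ y∈x = contradiction (x∈⁅y⁆⇒x≡y x y∈x) y≢x

  ∉-insert⁺ : y ∉ p → y ≢ x → y ∉ p ∪ ⁅ x ⁆
  ∉-insert⁺ y∉p y≢x y∈ = y∉p (∈-insert⁻ y∈ y≢x)

  insert⊆ : τ ⊆ V → x ∈ V → τ ∪ ⁅ x ⁆ ⊆ V
  insert⊆ {τ = τ} {x = x} τ⊆V x∈V y∈ with x∈p∪q⁻ τ ⁅ x ⁆ y∈
  ... | inj₁ y∈τ = τ⊆V y∈τ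
  ... | inj₂ y∈x = x∈p⇒⁅x⁆⊆p x∈V y∈x

  insert-mono : τ ⊆ σ → τ ∪ ⁅ x ⁆ ⊆ σ ∪ ⁅ x ⁆
  insert-mono {σ = σ} {x = x} τ⊆σ = insert⊆ (⊆-trans τ⊆σ (p⊆p∪q ⁅ x ⁆)) (x∈p∪⁅x⁆ σ x)

  insert-comm : ∀ (τ : Subset n) x y → (τ ∪ ⁅ x ⁆) ∪ ⁅ y ⁆ ≡ (τ ∪ ⁅ y ⁆) ∪ ⁅ x ⁆
  insert-comm τ x y = begin
    (τ ∪ ⁅ x ⁆) ∪ ⁅ y ⁆   ≡⟨ ∪-assoc τ ⁅ x ⁆ ⁅ y ⁆ ⟩
    τ ∪ (⁅ x ⁆ ∪ ⁅ y ⁆)   ≡⟨ cong (τ ∪_) (∪-comm ⁅ x ⁆ ⁅ y ⁆) ⟩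
    τ ∪ (⁅ y ⁆ ∪ ⁅ x ⁆)   ≡⟨ ∪-assoc τ ⁅ y ⁆ ⁅ x ⁆ ⟨
    (τ ∪ ⁅ y ⁆) ∪ ⁅ x ⁆   ∎
    where open ≡-Reasoning

  ∣insert∩∣ : ∀ (τ q : Subset n) x → x ∉ τ → ∣ (τ ∪ ⁅ x ⁆) ∩ q ∣ ≡ ∣ τ ∩ q ∣ + indicator (lookup q x)
  ∣insert∩∣ (false ∷ τ) (true  ∷ q) zero    _  rewrite ∪-identityʳ τ = +-comm 1 ∣ τ ∩ q ∣
  ∣insert∩∣ (false ∷ τ) (false ∷ q) zero    _  rewrite ∪-identityʳ τ = sym (+-comm ∣ τ ∩ q ∣ 0)
  ∣insert∩∣ (true  ∷ τ) _           zero    x∉ = contradiction here x∉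
  ∣insert∩∣ (false ∷ τ) (_     ∷ q) (suc x) x∉ = ∣insert∩∣ τ q x (λ x∈ → x∉ (there x∈))
  ∣insert∩∣ (true  ∷ τ) (false ∷ q) (suc x) x∉ = ∣insert∩∣ τ q x (λ x∈ → x∉ (there x∈))
  ∣insert∩∣ (true  ∷ τ) (true  ∷ q) (suc x) x∉ = cong suc (∣insert∩∣ τ q x (λ x∈ → x∉ (there x∈)))

  ∣insert∣ : ∀ (τ : Subset n) x → x ∉ τ → ∣ τ ∪ ⁅ x ⁆ ∣ ≡ suc ∣ τ ∣
  ∣insert∣ τ x x∉τ = begin
    ∣ τ ∪ ⁅ x ⁆ ∣              ≡⟨ cong ∣_∣ (∩-identityʳ (τ ∪ ⁅ x ⁆)) ⟨
    ∣ (τ ∪ ⁅ x ⁆) ∩ ⊤ ∣        ≡⟨ ∣insert∩∣ τ ⊤ x x∉τ ⟩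
    ∣ τ ∩ ⊤ ∣ + indicator (lookup ⊤ x)
                               ≡⟨ cong₂ (λ σ b → ∣ σ ∣ + indicator b) (∩-identityʳ τ) ([]=⇒lookup (∈⊤ {x = x})) ⟩
    ∣ τ ∣ + 1                  ≡⟨ +-comm ∣ τ ∣ 1 ⟩
    suc ∣ τ ∣                  ∎
    where open ≡-Reasoning

  x∉remove : ∀ (σ : Subset n) x → x ∉ σ [ x ]≔ false
  x∉remove σ x = lookup≡false⇒∉ (lookup∘update x σ false)

  remove⊆ : ∀ (σ : Subset n) x → σ [ x ]≔ false ⊆ σ
  remove⊆ σ x {y} y∈ with y ≟ x
  ... | yes refl = contradiction y∈ (x∉remove σ x)
  ... | no y≢x   = lookup⇒[]= y σ (trans (sym (lookup∘update′ y≢x σ false)) ([]=⇒lookup y∈))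

  ∈-remove⁺ : y ∈ σ → y ≢ x → y ∈ σ [ x ]≔ false
  ∈-remove⁺ {y = y} {σ = σ} y∈σ y≢x = lookup⇒[]= y _ (trans (lookup∘update′ y≢x σ false) ([]=⇒lookup y∈σ))

  ⊆remove : τ ⊆ V → x ∉ τ → τ ⊆ V [ x ]≔ false
  ⊆remove {x = x} τ⊆V x∉τ {y} y∈τ with y ≟ x
  ... | yes refl = contradiction y∈τ x∉τ
  ... | no y≢x   = ∈-remove⁺ (τ⊆V y∈τ) y≢x

  remove-mono : τ ⊆ σ → τ [ x ]≔ false ⊆ σ [ x ]≔ false
  remove-mono {τ = τ} {x = x} τ⊆σ = ⊆remove (⊆-trans (remove⊆ τ x) τ⊆σ) (x∉remove τ x)

  ∉⊆remove : σ ⊆ V [ x ]≔ false → x ∉ σ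
  ∉⊆remove {V = V} {x = x} σ⊆ x∈σ = x∉remove V x (σ⊆ x∈σ)

  ⊆remove-insert : ∀ (σ : Subset n) x → σ ⊆ (σ [ x ]≔ false) ∪ ⁅ x ⁆
  ⊆remove-insert σ x {y} y∈σ with y ≟ x
  ... | yes refl = x∈p∪⁅x⁆ _ y
  ... | no y≢x   = p⊆p∪q ⁅ x ⁆ (∈-remove⁺ y∈σ y≢x)

  remove-insert : ∀ (σ : Subset n) x → x ∈ σ → (σ [ x ]≔ false) ∪ ⁅ x ⁆ ≡ σ
  remove-insert σ x x∈σ = ⊆-antisym (insert⊆ (remove⊆ σ x) x∈σ) (⊆remove-insert σ x)

  insert-remove : ∀ (τ : Subset n) x → x ∉ τ → (τ ∪ ⁅ x ⁆) [ x ]≔ false ≡ τ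
  insert-remove τ x x∉τ = ⊆-antisym sub (⊆remove (p⊆p∪q ⁅ x ⁆) x∉τ)
    where
    sub : (τ ∪ ⁅ x ⁆) [ x ]≔ false ⊆ τ
    sub {y} y∈ with y ≟ x
    ... | yes refl = contradiction y∈ (x∉remove _ y)
    ... | no y≢x   = ∈-insert⁻ (remove⊆ _ x y∈) y≢x

  ∣remove∣ : ∀ (σ : Subset n) x → x ∈ σ → suc ∣ σ [ x ]≔ false ∣ ≡ ∣ σ ∣
  ∣remove∣ σ x x∈σ = trans (sym (∣insert∣ _ x (x∉remove σ x))) (cong ∣_∣ (remove-insert σ x x∈σ))

  ∣p∣≡0⇒p≡⊥ : ∀ (p : Subset n) → ∣ p ∣ ≡ 0 → p ≡ ⊥
  ∣p∣≡0⇒p≡⊥ []          _  = refl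
  ∣p∣≡0⇒p≡⊥ (false ∷ p) eq = cong (false ∷_) (∣p∣≡0⇒p≡⊥ p eq)

  ∣p∣>0⇒nonempty : ∀ (p : Subset n) → 0 < ∣ p ∣ → Nonempty p
  ∣p∣>0⇒nonempty (true  ∷ p) _ = zero , here
  ∣p∣>0⇒nonempty (false ∷ p) ∣p∣>0 with ∣p∣>0⇒nonempty p ∣p∣>0
  ... | x , x∈p = suc x , there x∈p

  x∈p⇒∣p∣>0 : x ∈ p → 0 < ∣ p ∣
  x∈p⇒∣p∣>0 {x = x} x∈p = ≤-trans (≤-reflexive (sym (∣⁅x⁆∣≡1 x))) (p⊆q⇒∣p∣≤∣q∣ (x∈p⇒⁅x⁆⊆p x∈p))

open SubsetLemmas

module RingSums {c ℓ} (R : Ring c ℓ) where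
  open import Data.Nat using (zero; suc)
  open import Data.Fin using (Fin; zero; suc; punchIn)
  open import Data.Fin.Properties using (punchInᵢ≢i)
  open import Data.Vec.Functional using (Vector)
  open import Function using (_∘_)
  open import Relation.Binary.PropositionalEquality using (_≢_)
  open Ring R hiding (zero)
  open import Algebra.Properties.Ring R using (-‿+-comm; -0#≈0#)
  open import Algebra.Properties.Semiring.Sum semiring public
  open import Relation.Binary.Reasoning.Setoid setoid

  sum-zero : ∀ {n} (f : Vector Carrier n) → (∀ i → f i ≈ 0#) → sum f ≈ 0#
  sum-zero {n} f f≈0 = trans (sum-cong-≋ f≈0) (sum-replicate-zero n)

  sum-neg : ∀ {n} (f : Vector Carrier n) → sum (λ i → - f i) ≈ - sum f
  sum-neg {zero}  f = sym -0#≈0#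
  sum-neg {suc n} f = trans (+-congˡ (sum-neg (f ∘ suc))) (-‿+-comm _ _)

  sum-single : ∀ {n} (f : Vector Carrier n) j → (∀ i → i ≢ j → f i ≈ 0#) → sum f ≈ f j
  sum-single {suc n} f j f≈0 = begin
    sum f                                   ≈⟨ sum-remove f ⟩
    f j + sum (λ i → f (punchIn j i))       ≈⟨ +-congˡ (sum-zero _ (λ i → f≈0 _ (punchInᵢ≢i j i))) ⟩
    f j + 0#                                ≈⟨ +-identityʳ _ ⟩
    f j                                     ∎

  sum-antisymmetric : ∀ {n} (f : Fin n → Fin n → Carrier) →
    (∀ i j → f i j ≈ - f j i) → (∀ i → f i i ≈ 0#) → sum (λ i → sum (f i)) ≈ 0#
  sum-antisymmetric {zero}  f anti diag = refl
  sum-antisymmetric {suc n} f anti diag = begin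
    sum (λ i → sum (f i))
      ≡⟨⟩
    (f zero zero + row) + sum (λ i → f (suc i) zero + sum (f (suc i) ∘ suc))
      ≈⟨ +-cong (+-congʳ (diag zero)) (∑-distrib-+ (λ i → f (suc i) zero) _) ⟩
    (0# + row) + (sum (λ i → f (suc i) zero) + sum (λ i → sum (f (suc i) ∘ suc)))
      ≈⟨ +-cong (+-identityˡ row) (+-cong (sum-cong-≋ (λ i → anti (suc i) zero))
                                          (sum-antisymmetric (λ i j → f (suc i) (suc j))
                                             (λ i j → anti (suc i) (suc j)) (diag ∘ suc))) ⟩
    row + (sum (λ i → - f zero (suc i)) + 0#)
      ≈⟨ +-congˡ (trans (+-identityʳ _) (sum-neg (f zero ∘ suc))) ⟩
    row + - row
      ≈⟨ -‿inverseʳ row ⟩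
    0# ∎
    where row = sum (f zero ∘ suc)

module ChainAlgebra {c ℓ : Level} (K : Field c ℓ) where
  open import Data.Nat as ℕ using (ℕ; zero; suc; _<ᵇ_)
  import Data.Nat.Properties as ℕ
  open import Data.Bool using (true; false; if_then_else_)
  open import Data.Fin using (Fin; zero; suc; toℕ)
  open import Data.Fin.Properties using (_≟_)
  open import Data.Fin.Subset using (_∪_; _∩_; ⁅_⁆; ∣_∣)
  open import Data.Fin.Subset.Properties using (p⊆p∪q; _∈?_)
  open import Data.List using (tabulate) renaming (foldr to foldrᴸ)
  open import Data.List.Properties using (map-tabulate)
  open import Data.Vec using (lookup; _[_]≔_)
  open import Data.Vec.Properties using ([]=⇒lookup; lookup∘tabulate)
  open import Function using (_∘_; id)
  open import Relation.Nullary using (yes; no)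
  open import Relation.Binary.PropositionalEquality as ≡ using (_≡_; _≢_; ≢-sym)
  open Field K hiding (zero)
  open Homology K
  open RingSums ring
  open import Algebra.Properties.Ring ring using (-‿distribˡ-*; -‿distribʳ-*; -‿involutive; -0#≈0#)
  open import Algebra.Properties.CommutativeSemigroup *-commutativeSemigroup using (x∙yz≈y∙xz)
  open import Relation.Binary.Reasoning.Setoid setoid

  private variable n : ℕ

  -‿vanishes : ∀ {a} → a ≈ 0# → - a ≈ 0#
  -‿vanishes a≈0 = trans (-‿cong a≈0) -0#≈0#

  sign-+ : ∀ m n → sign (m ℕ.+ n) ≈ sign m * sign n
  sign-+ zero    n = sym (*-identityˡ _)
  sign-+ (suc m) n = trans (-‿cong (sign-+ m n)) (-‿distribˡ-* _ _)

  sign-cancelˡ : ∀ m a → sign m * (sign m * a) ≈ a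
  sign-cancelˡ zero    a = trans (*-identityˡ _) (*-identityˡ a)
  sign-cancelˡ (suc m) a = begin
    - sign m * (- sign m * a)   ≈⟨ *-congˡ (-‿distribˡ-* _ _) ⟨
    - sign m * - (sign m * a)   ≈⟨ -‿distribˡ-* _ _ ⟨
    - (sign m * - (sign m * a)) ≈⟨ -‿cong (-‿distribʳ-* _ _) ⟨
    - - (sign m * (sign m * a)) ≈⟨ -‿involutive _ ⟩
    sign m * (sign m * a)       ≈⟨ sign-cancelˡ m a ⟩
    a                           ∎

  sign-flip : ∀ p q → p ℕ.+ q ≡ 1 → sign p ≈ - sign q
  sign-flip 0 1 ≡.refl = sym (-‿involutive 1#)
  sign-flip 1 0 ≡.refl = refl

  sign-exchange : ∀ a b p q → p ℕ.+ q ≡ 1 → sign a * sign (b ℕ.+ q) ≈ - (sign b * sign (a ℕ.+ p))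
  sign-exchange a b p q p+q≡1 = begin
    sign a * sign (b ℕ.+ q)          ≈⟨ *-congˡ (sign-+ b q) ⟩
    sign a * (sign b * sign q)       ≈⟨ x∙yz≈y∙xz _ _ _ ⟩
    sign b * (sign a * sign q)       ≈⟨ -‿involutive _ ⟨
    - - (sign b * (sign a * sign q)) ≈⟨ -‿cong (trans (-‿distribʳ-* _ _) (*-congˡ (-‿distribʳ-* _ _))) ⟩
    - (sign b * (sign a * - sign q)) ≈⟨ -‿cong (*-congˡ (*-congˡ (sign-flip p q p+q≡1))) ⟨
    - (sign b * (sign a * sign p))   ≈⟨ -‿cong (*-congˡ (sign-+ a p)) ⟨
    - (sign b * sign (a ℕ.+ p))      ∎

  sign-exchange′ : ∀ a b p q → p ℕ.+ q ≡ 1 → sign (a ℕ.+ p) * sign (b ℕ.+ q) ≈ - (sign b * sign a)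
  sign-exchange′ a b 0 1 ≡.refl rewrite ℕ.+-identityʳ a | ℕ.+-comm b 1 =
    trans (sym (-‿distribʳ-* _ _)) (-‿cong (*-comm _ _))
  sign-exchange′ a b 1 0 ≡.refl rewrite ℕ.+-identityʳ b | ℕ.+-comm a 1 =
    trans (sym (-‿distribˡ-* _ _)) (-‿cong (*-comm _ _))

  sumFin≡sum : ∀ {n} (f : Fin n → Carrier) → sumFin f ≡ sum f
  sumFin≡sum {n} f = ≡.trans (≡.cong (foldrᴸ _+_ 0#) (map-tabulate id f)) (foldr-tabulate f)
    where
    foldr-tabulate : ∀ {n} (f : Fin n → Carrier) → foldrᴸ _+_ 0# (tabulate f) ≡ sum f
    foldr-tabulate {zero}  f = ≡.refl
    foldr-tabulate {suc n} f = ≡.cong (f zero +_) (foldr-tabulate (f ∘ suc))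

  -- the sign of τ as a facet of τ ∪ ⁅ v ⁆
  incidence : Subset n → Fin n → Carrier
  incidence τ v = sign ∣ τ ∩ below v ∣

  incidence-cancelˡ : ∀ (τ : Subset n) v a → incidence τ v * (incidence τ v * a) ≈ a
  incidence-cancelˡ τ v = sign-cancelˡ ∣ τ ∩ below v ∣

  ∂-summand : Chain n → Subset n → Fin n → Carrier
  ∂-summand z τ v = if lookup τ v then 0# else incidence τ v * z (τ ∪ ⁅ v ⁆)

  ∂-as-sum : ∀ (z : Chain n) τ → ∂ z τ ≡ sum (∂-summand z τ)
  ∂-as-sum z τ = sumFin≡sum (∂-summand z τ)

  ∂-summand-∈ : ∀ (z : Chain n) {τ v} → v ∈ τ → ∂-summand z τ v ≡ 0#
  ∂-summand-∈ z v∈τ rewrite []=⇒lookup v∈τ = ≡.refl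

  ∂-summand-∉ : ∀ (z : Chain n) {τ v} → v ∉ τ → ∂-summand z τ v ≡ incidence τ v * z (τ ∪ ⁅ v ⁆)
  ∂-summand-∉ z v∉τ rewrite ∉⇒lookup≡false v∉τ = ≡.refl

  ∂-local : ∀ (z z′ : Chain n) τ → (∀ w → w ∉ τ → z (τ ∪ ⁅ w ⁆) ≈ z′ (τ ∪ ⁅ w ⁆)) → ∂ z τ ≈ ∂ z′ τ
  ∂-local z z′ τ agree = begin
    ∂ z τ                ≡⟨ ∂-as-sum z τ ⟩
    sum (∂-summand z τ)  ≈⟨ sum-cong-≋ summand-cong ⟩
    sum (∂-summand z′ τ) ≡⟨ ∂-as-sum z′ τ ⟨
    ∂ z′ τ               ∎
    where
    summand-cong : ∀ v → ∂-summand z τ v ≈ ∂-summand z′ τ v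
    summand-cong v with lookup τ v in eq
    ... | true  = refl
    ... | false = *-congˡ (agree v (lookup≡false⇒∉ eq))

  ∂-cong : ∀ {z z′ : Chain n} → (∀ σ → z σ ≈ z′ σ) → ∀ τ → ∂ z τ ≈ ∂ z′ τ
  ∂-cong {z = z} {z′} z≈z′ τ = ∂-local z z′ τ (λ w _ → z≈z′ (τ ∪ ⁅ w ⁆))

  ∂-+ : ∀ (z z′ : Chain n) τ → ∂ (λ σ → z σ + z′ σ) τ ≈ ∂ z τ + ∂ z′ τ
  ∂-+ z z′ τ = begin
    ∂ (λ σ → z σ + z′ σ) τ                                ≡⟨ ∂-as-sum (λ σ → z σ + z′ σ) τ ⟩
    sum (∂-summand (λ σ → z σ + z′ σ) τ)                  ≈⟨ sum-cong-≋ summand-+ ⟩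
    sum (λ v → ∂-summand z τ v + ∂-summand z′ τ v)        ≈⟨ ∑-distrib-+ (∂-summand z τ) (∂-summand z′ τ) ⟩
    sum (∂-summand z τ) + sum (∂-summand z′ τ)            ≡⟨ ≡.cong₂ _+_ (∂-as-sum z τ) (∂-as-sum z′ τ) ⟨
    ∂ z τ + ∂ z′ τ                                        ∎
    where
    summand-+ : ∀ v → ∂-summand (λ σ → z σ + z′ σ) τ v ≈ ∂-summand z τ v + ∂-summand z′ τ v
    summand-+ v with lookup τ v
    ... | true  = sym (+-identityˡ 0#)
    ... | false = distribˡ _ _ _

  ∂-neg : ∀ (z : Chain n) τ → ∂ (λ σ → - z σ) τ ≈ - ∂ z τ
  ∂-neg z τ = begin
    ∂ (λ σ → - z σ) τ                  ≡⟨ ∂-as-sum (λ σ → - z σ) τ ⟩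
    sum (∂-summand (λ σ → - z σ) τ)    ≈⟨ sum-cong-≋ summand-neg ⟩
    sum (λ v → - ∂-summand z τ v)      ≈⟨ sum-neg (∂-summand z τ) ⟩
    - sum (∂-summand z τ)              ≡⟨ ≡.cong -_ (∂-as-sum z τ) ⟨
    - ∂ z τ                            ∎
    where
    summand-neg : ∀ v → ∂-summand (λ σ → - z σ) τ v ≈ - ∂-summand z τ v
    summand-neg v with lookup τ v
    ... | true  = sym -0#≈0#
    ... | false = sym (-‿distribʳ-* _ _)

  ∂-zero : ∀ (z : Chain n) → (∀ σ → z σ ≈ 0#) → ∀ τ → ∂ z τ ≈ 0#
  ∂-zero z z≈0 τ = begin
    ∂ z τ               ≡⟨ ∂-as-sum z τ ⟩
    sum (∂-summand z τ) ≈⟨ sum-zero _ summand-zero ⟩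
    0#                  ∎
    where
    summand-zero : ∀ v → ∂-summand z τ v ≈ 0#
    summand-zero v with lookup τ v
    ... | true  = refl
    ... | false = trans (*-congˡ (z≈0 _)) (zeroʳ _)

  incidence-insert : ∀ {τ : Subset n} {x} w → x ∉ τ →
    incidence (τ ∪ ⁅ x ⁆) w ≡ sign (∣ τ ∩ below w ∣ ℕ.+ indicator (toℕ x <ᵇ toℕ w))
  incidence-insert {τ = τ} {x} w x∉τ = ≡.cong sign (≡.trans (∣insert∩∣ τ (below w) x x∉τ)
    (≡.cong (λ b → ∣ τ ∩ below w ∣ ℕ.+ indicator b) (lookup∘tabulate (λ u → toℕ u <ᵇ toℕ w) x)))

  -- Inserting x and w in either order: exactly one of x < w, w < x shifts the second count,
  -- so the two products of incidence signs differ by −1.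
  module _ {τ : Subset n} {x w} (x≢w : x ≢ w) (x∉τ : x ∉ τ) (w∉τ : w ∉ τ) where

    private
      w≢x : w ≢ x
      w≢x = ≢-sym x≢w

      precedence : indicator (toℕ x <ᵇ toℕ w) ℕ.+ indicator (toℕ w <ᵇ toℕ x) ≡ 1
      precedence = indicator-<ᵇ x w x≢w

    incidence-exchange : incidence τ w * incidence (τ ∪ ⁅ w ⁆) x ≈ - (incidence τ x * incidence (τ ∪ ⁅ x ⁆) w)
    incidence-exchange rewrite incidence-insert x w∉τ | incidence-insert w x∉τ =
      sign-exchange ∣ τ ∩ below w ∣ ∣ τ ∩ below x ∣ _ _ precedence

    incidence-exchange′ : incidence (τ ∪ ⁅ x ⁆) w * incidence (τ ∪ ⁅ w ⁆) x ≈ - (incidence τ x * incidence τ w)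
    incidence-exchange′ rewrite incidence-insert x w∉τ | incidence-insert w x∉τ =
      sign-exchange′ ∣ τ ∩ below w ∣ ∣ τ ∩ below x ∣ _ _ precedence

    ∂-summand-exchange : ∀ (z : Chain n) →
      incidence τ w * ∂-summand z (τ ∪ ⁅ w ⁆) x ≈ - (incidence τ x * ∂-summand z (τ ∪ ⁅ x ⁆) w)
    ∂-summand-exchange z = begin
      incidence τ w * ∂-summand z (τ ∪ ⁅ w ⁆) x
        ≡⟨ ≡.cong (incidence τ w *_) (∂-summand-∉ z (∉-insert⁺ x∉τ x≢w)) ⟩
      incidence τ w * (incidence (τ ∪ ⁅ w ⁆) x * z ((τ ∪ ⁅ w ⁆) ∪ ⁅ x ⁆))
        ≈⟨ *-assoc _ _ _ ⟨
      (incidence τ w * incidence (τ ∪ ⁅ w ⁆) x) * z ((τ ∪ ⁅ w ⁆) ∪ ⁅ x ⁆)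
        ≈⟨ *-cong incidence-exchange (reflexive (≡.cong z (insert-comm τ w x))) ⟩
      - (incidence τ x * incidence (τ ∪ ⁅ x ⁆) w) * z ((τ ∪ ⁅ x ⁆) ∪ ⁅ w ⁆)
        ≈⟨ -‿distribˡ-* _ _ ⟨
      - ((incidence τ x * incidence (τ ∪ ⁅ x ⁆) w) * z ((τ ∪ ⁅ x ⁆) ∪ ⁅ w ⁆))
        ≈⟨ -‿cong (*-assoc _ _ _) ⟩
      - (incidence τ x * (incidence (τ ∪ ⁅ x ⁆) w * z ((τ ∪ ⁅ x ⁆) ∪ ⁅ w ⁆)))
        ≡⟨ ≡.cong (λ t → - (incidence τ x * t)) (∂-summand-∉ z (∉-insert⁺ w∉τ w≢x)) ⟨
      - (incidence τ x * ∂-summand z (τ ∪ ⁅ x ⁆) w)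
        ∎

  ∂∘∂≈0 : ∀ (z : Chain n) τ → ∂ (∂ z) τ ≈ 0#
  ∂∘∂≈0 {n} z τ = begin
    ∂ (∂ z) τ                  ≡⟨ ∂-as-sum (∂ z) τ ⟩
    sum (∂-summand (∂ z) τ)    ≈⟨ sum-cong-≋ expand ⟩
    sum (λ w → sum (f w))      ≈⟨ sum-antisymmetric f antisymmetric diagonal ⟩
    0#                         ∎
    where
    summand : Fin n → Chain n
    summand w′ σ = ∂-summand z σ w′

    f : Fin n → Fin n → Carrier
    f w w′ = ∂-summand (summand w′) τ w

    vanishesʳ : ∀ w {w′} → w′ ∈ τ → f w w′ ≈ 0#
    vanishesʳ w {w′} w′∈τ with w ∈? τ
    ... | yes w∈τ = reflexive (∂-summand-∈ (summand w′) w∈τ)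
    ... | no  w∉τ = trans (reflexive (∂-summand-∉ (summand w′) w∉τ))
                          (trans (*-congˡ (reflexive (∂-summand-∈ z (p⊆p∪q ⁅ w ⁆ w′∈τ)))) (zeroʳ _))

    diagonal : ∀ w → f w w ≈ 0#
    diagonal w with w ∈? τ
    ... | yes w∈τ = reflexive (∂-summand-∈ (summand w) w∈τ)
    ... | no  w∉τ = trans (reflexive (∂-summand-∉ (summand w) w∉τ))
                          (trans (*-congˡ (reflexive (∂-summand-∈ z (x∈p∪⁅x⁆ τ w)))) (zeroʳ _))

    antisymmetric : ∀ w w′ → f w w′ ≈ - f w′ w
    antisymmetric w w′ with w ∈? τ | w′ ∈? τ | w ≟ w′
    ... | yes w∈τ | _        | _          = trans (reflexive (∂-summand-∈ (summand w′) w∈τ))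
                                                   (sym (-‿vanishes (vanishesʳ w′ w∈τ)))
    ... | no _    | yes w′∈τ | _          = trans (vanishesʳ w w′∈τ)
                                                   (sym (-‿vanishes (reflexive (∂-summand-∈ (summand w) w′∈τ))))
    ... | no _    | no _     | yes ≡.refl = trans (diagonal w) (sym (-‿vanishes (diagonal w)))
    ... | no w∉τ  | no w′∉τ  | no w≢w′    = begin
      f w w′                                             ≡⟨ ∂-summand-∉ (summand w′) w∉τ ⟩
      incidence τ w * ∂-summand z (τ ∪ ⁅ w ⁆) w′         ≈⟨ ∂-summand-exchange (≢-sym w≢w′) w′∉τ w∉τ z ⟩
      - (incidence τ w′ * ∂-summand z (τ ∪ ⁅ w′ ⁆) w)    ≡⟨ ≡.cong -_ (∂-summand-∉ (summand w) w′∉τ) ⟨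
      - f w′ w                                           ∎

    expand : ∀ w → ∂-summand (∂ z) τ w ≈ sum (f w)
    expand w with w ∈? τ
    ... | yes w∈τ = trans (reflexive (∂-summand-∈ (∂ z) w∈τ))
                          (sym (sum-zero _ (λ w′ → reflexive (∂-summand-∈ (summand w′) w∈τ))))
    ... | no  w∉τ = begin
      ∂-summand (∂ z) τ w                           ≡⟨ ∂-summand-∉ (∂ z) w∉τ ⟩
      incidence τ w * ∂ z σ                         ≡⟨ ≡.cong (incidence τ w *_) (∂-as-sum z σ) ⟩
      incidence τ w * sum (∂-summand z σ)           ≈⟨ *-distribˡ-sum (incidence τ w) (∂-summand z σ) ⟩
      sum (λ w′ → incidence τ w * ∂-summand z σ w′) ≡⟨ sum-cong-≗ (λ w′ → ∂-summand-∉ (summand w′) w∉τ) ⟨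
      sum (f w)                                     ∎
      where σ = τ ∪ ⁅ w ⁆

  -- coning with apex x, on coefficients: the face τ ∌ x goes to ± (τ ∪ ⁅ x ⁆)
  cone : Fin n → Chain n → Chain n
  cone x z σ = if lookup σ x then incidence (σ [ x ]≔ false) x * z (σ [ x ]≔ false) else 0#

  cone-∉ : ∀ x (z : Chain n) {σ} → x ∉ σ → cone x z σ ≡ 0#
  cone-∉ x z x∉σ rewrite ∉⇒lookup≡false x∉σ = ≡.refl

  cone-insert : ∀ x (z : Chain n) {τ} → x ∉ τ → cone x z (τ ∪ ⁅ x ⁆) ≡ incidence τ x * z τ
  cone-insert x z {τ} x∉τ rewrite []=⇒lookup (x∈p∪⁅x⁆ τ x) | insert-remove τ x x∉τ = ≡.refl

  cone-vanishes : ∀ x {z : Chain n} → (∀ σ → z σ ≈ 0#) → ∀ σ → cone x z σ ≈ 0#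
  cone-vanishes x z≈0 σ with lookup σ x
  ... | true  = trans (*-congˡ (z≈0 _)) (zeroʳ _)
  ... | false = refl

  ∂-cone-∉ : ∀ x (z : Chain n) {τ} → x ∉ τ → ∂ (cone x z) τ ≈ z τ
  ∂-cone-∉ x z {τ} x∉τ = begin
    ∂ (cone x z) τ                     ≡⟨ ∂-as-sum (cone x z) τ ⟩
    sum (∂-summand (cone x z) τ)       ≈⟨ sum-single _ x others-vanish ⟩
    ∂-summand (cone x z) τ x           ≡⟨ ∂-summand-∉ (cone x z) x∉τ ⟩
    incidence τ x * cone x z (τ ∪ ⁅ x ⁆) ≡⟨ ≡.cong (incidence τ x *_) (cone-insert x z x∉τ) ⟩
    incidence τ x * (incidence τ x * z τ) ≈⟨ incidence-cancelˡ τ x (z τ) ⟩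
    z τ                                ∎
    where
    others-vanish : ∀ w → w ≢ x → ∂-summand (cone x z) τ w ≈ 0#
    others-vanish w w≢x with w ∈? τ
    ... | yes w∈τ = reflexive (∂-summand-∈ (cone x z) w∈τ)
    ... | no  w∉τ = begin
      ∂-summand (cone x z) τ w              ≡⟨ ∂-summand-∉ (cone x z) w∉τ ⟩
      incidence τ w * cone x z (τ ∪ ⁅ w ⁆)  ≡⟨ ≡.cong (incidence τ w *_) (cone-∉ x z (∉-insert⁺ x∉τ (≢-sym w≢x))) ⟩
      incidence τ w * 0#                    ≈⟨ zeroʳ _ ⟩
      0#                                    ∎

  ∂-cone-insert : ∀ x (z : Chain n) {τ} → x ∉ τ →
    ∂ (cone x z) (τ ∪ ⁅ x ⁆) + incidence τ x * ∂ z τ ≈ z (τ ∪ ⁅ x ⁆)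
  ∂-cone-insert {n} x z {τ} x∉τ = begin
    ∂ (cone x z) σ + incidence τ x * ∂ z τ
      ≡⟨ ≡.cong₂ (λ a b → a + incidence τ x * b) (∂-as-sum (cone x z) σ) (∂-as-sum z τ) ⟩
    sum (∂-summand (cone x z) σ) + incidence τ x * sum (∂-summand z τ)
      ≈⟨ +-congˡ (*-distribˡ-sum (incidence τ x) (∂-summand z τ)) ⟩
    sum (∂-summand (cone x z) σ) + sum (λ w → incidence τ x * ∂-summand z τ w)
      ≈⟨ ∑-distrib-+ (∂-summand (cone x z) σ) _ ⟨
    sum F
      ≈⟨ sum-single F x others-cancel ⟩
    ∂-summand (cone x z) σ x + incidence τ x * ∂-summand z τ x
      ≡⟨ ≡.cong₂ (λ a b → a + incidence τ x * b) (∂-summand-∈ (cone x z) (x∈p∪⁅x⁆ τ x)) (∂-summand-∉ z x∉τ) ⟩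
    0# + incidence τ x * (incidence τ x * z σ)
      ≈⟨ trans (+-identityˡ _) (incidence-cancelˡ τ x (z σ)) ⟩
    z σ ∎
    where
    σ = τ ∪ ⁅ x ⁆

    F : Fin n → Carrier
    F w = ∂-summand (cone x z) σ w + incidence τ x * ∂-summand z τ w

    others-cancel : ∀ w → w ≢ x → F w ≈ 0#
    others-cancel w w≢x with w ∈? τ
    ... | yes w∈τ = begin
      F w              ≡⟨ ≡.cong₂ (λ a b → a + incidence τ x * b)
                                  (∂-summand-∈ (cone x z) (p⊆p∪q ⁅ x ⁆ w∈τ)) (∂-summand-∈ z w∈τ) ⟩
      0# + incidence τ x * 0#   ≈⟨ trans (+-identityˡ _) (zeroʳ _) ⟩
      0#               ∎
    ... | no  w∉τ = begin
      F w
        ≡⟨ ≡.cong₂ (λ a b → a + incidence τ x * b)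
                   (∂-summand-∉ (cone x z) (∉-insert⁺ w∉τ w≢x)) (∂-summand-∉ z w∉τ) ⟩
      incidence σ w * cone x z (σ ∪ ⁅ w ⁆) + incidence τ x * (incidence τ w * Z)
        ≡⟨ ≡.cong (λ ρ → incidence σ w * cone x z ρ + incidence τ x * (incidence τ w * Z)) (insert-comm τ x w) ⟩
      incidence σ w * cone x z ((τ ∪ ⁅ w ⁆) ∪ ⁅ x ⁆) + incidence τ x * (incidence τ w * Z)
        ≡⟨ ≡.cong (λ a → incidence σ w * a + incidence τ x * (incidence τ w * Z))
                  (cone-insert x z (∉-insert⁺ x∉τ (≢-sym w≢x))) ⟩
      incidence σ w * (incidence (τ ∪ ⁅ w ⁆) x * Z) + incidence τ x * (incidence τ w * Z)
        ≈⟨ +-cong (*-assoc _ _ _) (*-assoc _ _ _) ⟨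
      (incidence σ w * incidence (τ ∪ ⁅ w ⁆) x) * Z + (incidence τ x * incidence τ w) * Z
        ≈⟨ distribʳ Z _ _ ⟨
      (incidence σ w * incidence (τ ∪ ⁅ w ⁆) x + incidence τ x * incidence τ w) * Z
        ≈⟨ *-congʳ (trans (+-congʳ (incidence-exchange′ (≢-sym w≢x) x∉τ w∉τ)) (-‿inverseˡ _)) ⟩
      0# * Z
        ≈⟨ zeroˡ Z ⟩
      0# ∎
      where Z = z (τ ∪ ⁅ w ⁆)

  cone-homotopy : ∀ x (z : Chain n) τ → ∂ (cone x z) τ + cone x (∂ z) τ ≈ z τ
  cone-homotopy x z τ with x ∈? τ
  ... | no x∉τ = trans (+-cong (∂-cone-∉ x z x∉τ) (reflexive (cone-∉ x (∂ z) x∉τ))) (+-identityʳ (z τ))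
  ... | yes x∈τ = ≡.subst (λ σ → ∂ (cone x z) σ + cone x (∂ z) σ ≈ z σ) (remove-insert τ x x∈τ)
    (trans (+-congˡ (reflexive (cone-insert x (∂ z) x∉τ′))) (∂-cone-insert x z x∉τ′))
    where x∉τ′ = x∉remove τ x

  -- the part of z on faces through x, read on the link of x
  link : Fin n → Chain n → Chain n
  link x z τ = ∂-summand z τ x

  ∂-link : ∀ x (z : Chain n) τ → ∂ (link x z) τ ≈ - link x (∂ z) τ
  ∂-link x z τ with x ∈? τ
  ... | yes x∈τ = begin
    ∂ (link x z) τ                 ≡⟨ ∂-as-sum (link x z) τ ⟩
    sum (∂-summand (link x z) τ)   ≈⟨ sum-zero _ summand-vanishes ⟩
    0#                             ≈⟨ -‿vanishes (reflexive (∂-summand-∈ (∂ z) x∈τ)) ⟨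
    - link x (∂ z) τ               ∎
    where
    summand-vanishes : ∀ w → ∂-summand (link x z) τ w ≈ 0#
    summand-vanishes w with w ∈? τ
    ... | yes w∈τ = reflexive (∂-summand-∈ (link x z) w∈τ)
    ... | no  w∉τ = trans (reflexive (∂-summand-∉ (link x z) w∉τ))
                          (trans (*-congˡ (reflexive (∂-summand-∈ z (p⊆p∪q ⁅ w ⁆ x∈τ)))) (zeroʳ _))
  ... | no x∉τ = begin
    ∂ (link x z) τ                                        ≡⟨ ∂-as-sum (link x z) τ ⟩
    sum (∂-summand (link x z) τ)                          ≈⟨ sum-cong-≋ summand-link ⟩
    sum (λ w → - (incidence τ x * ∂-summand z σ w))       ≈⟨ sum-neg (λ w → incidence τ x * ∂-summand z σ w) ⟩
    - sum (λ w → incidence τ x * ∂-summand z σ w)         ≈⟨ -‿cong (*-distribˡ-sum (incidence τ x) (∂-summand z σ)) ⟨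
    - (incidence τ x * sum (∂-summand z σ))               ≡⟨ ≡.cong (λ a → - (incidence τ x * a)) (∂-as-sum z σ) ⟨
    - (incidence τ x * ∂ z σ)                             ≡⟨ ≡.cong -_ (∂-summand-∉ (∂ z) x∉τ) ⟨
    - link x (∂ z) τ                                      ∎
    where
    σ = τ ∪ ⁅ x ⁆

    vanishes-at : ∀ {w} → w ∈ σ → - (incidence τ x * ∂-summand z σ w) ≈ 0#
    vanishes-at w∈σ = -‿vanishes (trans (*-congˡ (reflexive (∂-summand-∈ z w∈σ))) (zeroʳ _))

    summand-link : ∀ w → ∂-summand (link x z) τ w ≈ - (incidence τ x * ∂-summand z σ w)
    summand-link w with w ∈? τ | x ≟ w
    ... | yes w∈τ | _         = trans (reflexive (∂-summand-∈ (link x z) w∈τ)) (sym (vanishes-at (p⊆p∪q ⁅ x ⁆ w∈τ)))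
    ... | no  w∉τ | yes ≡.refl = trans (reflexive (∂-summand-∉ (link x z) w∉τ))
        (trans (trans (*-congˡ (reflexive (∂-summand-∈ z (x∈p∪⁅x⁆ τ x)))) (zeroʳ _)) (sym (vanishes-at (x∈p∪⁅x⁆ τ x))))
    ... | no  w∉τ | no x≢w    = trans (reflexive (∂-summand-∉ (link x z) w∉τ)) (∂-summand-exchange x≢w x∉τ w∉τ z)

  cone-link : ∀ x (z : Chain n) {σ} → x ∈ σ → cone x (link x z) σ ≈ z σ
  cone-link x z {σ} x∈σ = ≡.subst (λ ρ → cone x (link x z) ρ ≈ z ρ) (remove-insert σ x x∈σ) (begin
    cone x (link x z) (τ ∪ ⁅ x ⁆)              ≡⟨ cone-insert x (link x z) x∉τ ⟩
    incidence τ x * link x z τ                 ≡⟨ ≡.cong (incidence τ x *_) (∂-summand-∉ z x∉τ) ⟩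
    incidence τ x * (incidence τ x * z (τ ∪ ⁅ x ⁆)) ≈⟨ incidence-cancelˡ τ x _ ⟩
    z (τ ∪ ⁅ x ⁆)                              ∎)
    where
    τ = σ [ x ]≔ false
    x∉τ = x∉remove σ x

  cone-cong : ∀ x {z z′ : Chain n} → (∀ σ → z σ ≈ z′ σ) → ∀ σ → cone x z σ ≈ cone x z′ σ
  cone-cong x z≈z′ σ with lookup σ x
  ... | true  = *-congˡ (z≈z′ _)
  ... | false = refl

  link-vanishes : ∀ x {z : Chain n} → (∀ σ → z σ ≈ 0#) → ∀ τ → link x z τ ≈ 0#
  link-vanishes x z≈0 τ with lookup τ x
  ... | true  = refl
  ... | false = trans (*-congˡ (z≈0 _)) (zeroʳ _)

module Complexes where
  open import Level using (_⊔_)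
  open import Data.Bool using (false)
  open import Data.Fin.Subset using (_⊆_; _∪_; ⁅_⁆)
  open import Data.Fin.Subset.Properties using (⊆-trans; p⊆p∪q; _∈?_)
  open import Data.Product using (Σ; ∃; _×_; _,_)
  open import Data.Vec using (_[_]≔_)
  open import Relation.Nullary using (¬_; Dec)
  open import Relation.Nullary.Decidable using (_×-dec_; ¬?)
  open import Relation.Binary.PropositionalEquality using (_≡_)

  record Complex (n : ℕ) : Set₁ where
    field
      face        : Subset n → Set
      face?       : ∀ σ → Dec (face σ)
      face-⊆      : ∀ {σ τ} → τ ⊆ σ → face σ → face τ
      ground      : Subset n
      face⊆ground : ∀ {σ} → face σ → σ ⊆ ground

  open Complex public

  private variable n : ℕ

  del : Complex n → Fin n → Complex n
  del Γ x = record
    { face        = λ σ → face Γ σ × x ∉ σ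
    ; face?       = λ σ → face? Γ σ ×-dec ¬? (x ∈? σ)
    ; face-⊆      = λ τ⊆σ (f , x∉σ) → face-⊆ Γ τ⊆σ f , (λ x∈τ → x∉σ (τ⊆σ x∈τ))
    ; ground      = ground Γ [ x ]≔ false
    ; face⊆ground = λ (f , x∉σ) → ⊆remove (face⊆ground Γ f) x∉σ
    }

  lk : Complex n → Fin n → Complex n
  lk Γ x = record
    { face        = λ σ → face Γ (σ ∪ ⁅ x ⁆) × x ∉ σ
    ; face?       = λ σ → face? Γ (σ ∪ ⁅ x ⁆) ×-dec ¬? (x ∈? σ)
    ; face-⊆      = λ τ⊆σ (f , x∉σ) → face-⊆ Γ (insert-mono τ⊆σ) f , (λ x∈τ → x∉σ (τ⊆σ x∈τ))
    ; ground      = ground Γ [ x ]≔ false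
    ; face⊆ground = λ (f , x∉σ) → ⊆remove (⊆-trans (p⊆p∪q ⁅ x ⁆) (face⊆ground Γ f)) x∉σ
    }

  -- I_Γ is generated in degree ≤ s, i.e. minimal non-faces have at most s vertices
  GeneratedInDegree≤ : ℕ → Complex n → Set
  GeneratedInDegree≤ s Γ = ∀ σ → σ ⊆ ground Γ → ¬ face Γ σ → ∃ λ ρ → ρ ⊆ σ × ¬ face Γ ρ × ∣ ρ ∣ ≤ s

  -- Chains are indexed by the number k of vertices of their simplices, so NontrivialHomology Γ k
  -- says H̃_{k-1}(Γ) ≠ 0; ReducedHomologyNonzero K Δ W i is NontrivialHomology (restriction Δ W) (suc i).
  module ReducedHomology {c ℓ : Level} (K : Field c ℓ) where
    open Field K using (_≈_; 0#)
    open Homology K using (Chain; ∂)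

    Supported : (Subset n → Set) → ℕ → Chain n → Set ℓ
    Supported P k z = ∀ σ → ¬ (P σ × ∣ σ ∣ ≡ k) → z σ ≈ 0#

    Cycle : Chain n → Set ℓ
    Cycle z = ∀ τ → ∂ z τ ≈ 0#

    IsBoundary : Complex n → ℕ → Chain n → Set (c ⊔ ℓ)
    IsBoundary Γ k z = Σ (Chain _) λ b → Supported (face Γ) (suc k) b × (∀ σ → ∂ b σ ≈ z σ)

    NontrivialHomology : Complex n → ℕ → Set (c ⊔ ℓ)
    NontrivialHomology Γ k = Σ (Chain _) λ z → Supported (face Γ) k z × Cycle z × ¬ IsBoundary Γ k z

open Complexes

module Arithmetic where
  open import Data.Nat
  open import Data.Nat.Properties
  open import Data.Nat.DivMod using (_/_; m<n*o⇒m/o<n)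
  open import Data.Nat.Tactic.RingSolver using (solve-∀)
  open import Relation.Binary.PropositionalEquality

  add-vertex : ∀ t m k r → suc t * k ≤ t * m + r → suc t * suc k ≤ t * suc m + suc r
  add-vertex t m k r bound = begin
    suc t * suc k          ≡⟨ *-suc (suc t) k ⟩
    suc t + suc t * k      ≤⟨ +-monoʳ-≤ (suc t) bound ⟩
    suc t + (t * m + r)    ≡⟨ rearrange t m r ⟩
    t * suc m + suc r      ∎
    where
    open ≤-Reasoning
    rearrange : ∀ t m r → suc t + (t * m + r) ≡ t * suc m + suc r
    rearrange = solve-∀

  drop-small-summand : ∀ t m k a → suc t * suc (suc k) ≤ t * m + a → a ≤ suc t → suc t * suc k ≤ t * m
  drop-small-summand t m k a bound a≤s = +-cancelˡ-≤ (suc t) (suc t * suc k) (t * m) (begin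
    suc t + suc t * suc k  ≡⟨ *-suc (suc t) (suc k) ⟨
    suc t * suc (suc k)    ≤⟨ bound ⟩
    t * m + a              ≤⟨ +-monoʳ-≤ (t * m) a≤s ⟩
    t * m + suc t          ≡⟨ +-comm (t * m) (suc t) ⟩
    suc t + t * m          ∎)
    where open ≤-Reasoning

  ⌈/⌉-≤ : ∀ a b M → a ≤ suc b * M → ⌈ a / suc b ⌉ ≤ M
  ⌈/⌉-≤ a b M a≤ = <⇒≤pred (m<n*o⇒m/o<n (begin-strict
    a + b                  ≤⟨ +-monoˡ-≤ b a≤ ⟩
    suc b * M + b          <⟨ +-monoʳ-< (suc b * M) (n<1+n b) ⟩
    suc b * M + suc b      ≡⟨ rearrange M b ⟩
    suc M * suc b          ∎))
    where
    open ≤-Reasoning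
    rearrange : ∀ M b → suc b * M + suc b ≡ suc M * suc b
    rearrange = solve-∀

  ⌈/⌉-< : ∀ t h N → suc (suc t) * suc h ≤ suc t * N → ⌈ suc (suc t) * h / suc t ⌉ < N
  ⌈/⌉-< t h N bound = m<n*o⇒m/o<n (begin-strict
    suc (suc t) * h + t            <⟨ +-monoʳ-< (suc (suc t) * h) (m<n⇒m<1+n (n<1+n t)) ⟩
    suc (suc t) * h + suc (suc t)  ≡⟨ +-comm _ (suc (suc t)) ⟩
    suc (suc t) + suc (suc t) * h  ≡⟨ *-suc (suc (suc t)) h ⟨
    suc (suc t) * suc h            ≤⟨ bound ⟩
    suc t * N                      ≡⟨ *-comm (suc t) N ⟩
    N * suc t                      ∎)
    where open ≤-Reasoning

module HomologyOfComplexes {c ℓ : Level} (K : Field c ℓ) where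
  open import Data.Nat using (zero; _<_; z≤n; s≤s)
  import Data.Nat.Properties as ℕ
  open import Data.Bool using (true; false)
  open import Data.Fin.Subset using (_⊆_; _∪_; ⁅_⁆; ⊥; Nonempty)
  open import Data.Fin.Subset.Properties using (⊆-trans; ⊆-min; p⊆p∪q; p⊆q⇒∣p∣≤∣q∣; _∈?_)
  open import Data.Vec using (lookup; _[_]≔_)
  open import Data.Vec.Properties using (lookup⇒[]=)
  open import Data.Product using (_×_; _,_; proj₁)
  open import Relation.Nullary using (¬_; yes; no)
  open import Relation.Nullary.Negation using (contradiction)
  open import Relation.Binary.PropositionalEquality as ≡ using (_≡_; _≢_)
  open Field K hiding (zero)
  open Homology K using (Chain; ∂)
  open ChainAlgebra K
  open ReducedHomology K
  open import Relation.Binary.Reasoning.Setoid setoid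

  private variable
    n k : ℕ
    P Q : Subset n → Set

  Supported-mono : (∀ {σ} → P σ → Q σ) → ∀ {z : Chain n} → Supported P k z → Supported Q k z
  Supported-mono P⇒Q z-supp σ ¬Qσ = z-supp σ (λ (Pσ , size) → ¬Qσ (P⇒Q Pσ , size))

  Supported-+ : ∀ {z w : Chain n} → Supported P k z → Supported P k w → Supported P k (λ σ → z σ + w σ)
  Supported-+ z-supp w-supp σ ¬Pσ = trans (+-cong (z-supp σ ¬Pσ) (w-supp σ ¬Pσ)) (+-identityˡ 0#)

  Supported-neg : ∀ {z : Chain n} → Supported P k z → Supported P k (λ σ → - z σ)
  Supported-neg z-supp σ ¬Pσ = -‿vanishes (z-supp σ ¬Pσ)

  zero-isBoundary : ∀ (Γ : Complex n) k {z} → (∀ σ → z σ ≈ 0#) → IsBoundary Γ k z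
  zero-isBoundary Γ k z≈0 = (λ _ → 0#) , (λ _ _ → refl) , (λ σ → trans (∂-zero _ (λ _ → refl) σ) (sym (z≈0 σ)))

  IsBoundary-+ : ∀ {Γ : Complex n} {z w} → IsBoundary Γ k z → IsBoundary Γ k w → IsBoundary Γ k (λ σ → z σ + w σ)
  IsBoundary-+ (b , b-supp , ∂b≈z) (b′ , b′-supp , ∂b′≈w) =
    (λ σ → b σ + b′ σ) , Supported-+ b-supp b′-supp , λ σ → trans (∂-+ b b′ σ) (+-cong (∂b≈z σ) (∂b′≈w σ))

  IsBoundary-≈ : ∀ {Γ : Complex n} {z w} → (∀ σ → z σ ≈ w σ) → IsBoundary Γ k z → IsBoundary Γ k w
  IsBoundary-≈ z≈w (b , b-supp , ∂b≈z) = b , b-supp , λ σ → trans (∂b≈z σ) (z≈w σ)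

  IsBoundary-mono : ∀ {Γ Γ′ : Complex n} {z} → (∀ {σ} → face Γ σ → face Γ′ σ) → IsBoundary Γ k z → IsBoundary Γ′ k z
  IsBoundary-mono Γ⊆Γ′ (b , b-supp , ∂b≈z) = b , Supported-mono Γ⊆Γ′ b-supp , ∂b≈z

  cone-supported : ∀ y → (∀ {τ} → y ∉ τ → P τ → Q (τ ∪ ⁅ y ⁆)) →
    ∀ {z : Chain n} → Supported P k z → Supported Q (suc k) (cone y z)
  cone-supported {P = P} {Q} {k = k} y extend {z} z-supp σ ¬Qσ with lookup σ y in eq
  ... | false = refl
  ... | true  = trans (*-congˡ (z-supp τ ¬Pτ)) (zeroʳ _)
    where
    τ = σ [ y ]≔ false
    y∈σ = lookup⇒[]= y σ eq
    ¬Pτ : ¬ (P τ × ∣ τ ∣ ≡ k)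
    ¬Pτ (Pτ , ∣τ∣≡k) = ¬Qσ ( ≡.subst Q (remove-insert σ y y∈σ) (extend (x∉remove σ y) Pτ)
                           , ≡.trans (≡.sym (∣remove∣ σ y y∈σ)) (≡.cong suc ∣τ∣≡k))

  ∂-cone-cycle : ∀ x {z : Chain n} → Cycle z → ∀ σ → ∂ (cone x z) σ ≈ z σ
  ∂-cone-cycle x {z} z-cycle σ = begin
    ∂ (cone x z) σ                        ≈⟨ +-identityʳ _ ⟨
    ∂ (cone x z) σ + 0#                   ≈⟨ +-congˡ (cone-vanishes x z-cycle σ) ⟨
    ∂ (cone x z) σ + cone x (∂ z) σ       ≈⟨ cone-homotopy x z σ ⟩
    z σ                                   ∎

  cone-acyclic : ∀ (Γ : Complex n) y → (∀ {τ} → face Γ τ → face Γ (τ ∪ ⁅ y ⁆)) → ¬ NontrivialHomology Γ k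
  cone-acyclic Γ y apex (z , z-supp , z-cycle , ¬bd) =
    ¬bd (cone y z , cone-supported y (λ _ → apex) z-supp , ∂-cone-cycle y z-cycle)

  nontrivial⇒∅∈Γ : ∀ (Γ : Complex n) → NontrivialHomology Γ k → face Γ ⊥
  nontrivial⇒∅∈Γ {k = k} Γ (z , z-supp , _ , ¬bd) with face? Γ ⊥
  ... | yes ∅∈Γ = ∅∈Γ
  ... | no  ∅∉Γ = contradiction (zero-isBoundary Γ k (λ σ → z-supp σ (λ (σ∈Γ , _) → ∅∉Γ (face-⊆ Γ (⊆-min σ) σ∈Γ))))
                                ¬bd

  -- if the ground set is a face, Γ is a cone over any vertex (or has no nonempty face at all)
  ground-nonface : ∀ (Γ : Complex n) → NontrivialHomology Γ (suc k) → ¬ face Γ (ground Γ)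
  ground-nonface {k = k} Γ H@(z , z-supp , _ , ¬bd) V∈Γ with ∣ ground Γ ∣ in ∣V∣≡
  ... | zero  = ¬bd (zero-isBoundary Γ (suc k) (λ σ → z-supp σ (λ (σ∈Γ , ∣σ∣≡) → too-large σ∈Γ ∣σ∣≡)))
    where
    too-large : ∀ {σ} → face Γ σ → ∣ σ ∣ ≢ suc k
    too-large σ∈Γ ∣σ∣≡ with () ← ≡.subst₂ _≤_ ∣σ∣≡ ∣V∣≡ (p⊆q⇒∣p∣≤∣q∣ (face⊆ground Γ σ∈Γ))
  ... | suc _ with ∣p∣>0⇒nonempty (ground Γ) (≡.subst (0 <_) (≡.sym ∣V∣≡) (s≤s z≤n))
  ...   | y , y∈V = cone-acyclic Γ y (λ τ∈Γ → face-⊆ Γ (insert⊆ (face⊆ground Γ τ∈Γ) y∈V) V∈Γ) H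

  del-generated : ∀ {s} (Γ : Complex n) x → GeneratedInDegree≤ s Γ → GeneratedInDegree≤ s (del Γ x)
  del-generated Γ x gen σ σ⊆V ¬del with gen σ (⊆-trans σ⊆V (remove⊆ _ x)) (λ σ∈Γ → ¬del (σ∈Γ , ∉⊆remove σ⊆V))
  ... | ρ , ρ⊆σ , ρ∉Γ , small = ρ , ρ⊆σ , (λ (ρ∈Γ , _) → ρ∉Γ ρ∈Γ) , small

  lk-generated : ∀ {s} (Γ : Complex n) {x} → x ∈ ground Γ → GeneratedInDegree≤ s Γ → GeneratedInDegree≤ s (lk Γ x)
  lk-generated Γ {x} x∈V gen σ σ⊆V ¬lk
    with gen (σ ∪ ⁅ x ⁆) (insert⊆ (⊆-trans σ⊆V (remove⊆ _ x)) x∈V) (λ σx∈Γ → ¬lk (σx∈Γ , ∉⊆remove σ⊆V))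
  ... | ρ , ρ⊆σx , ρ∉Γ , small =
    ρ [ x ]≔ false ,
    ≡.subst (ρ [ x ]≔ false ⊆_) (insert-remove σ x (∉⊆remove σ⊆V)) (remove-mono ρ⊆σx) ,
    (λ (ρ-x∈lk , _) → ρ∉Γ (face-⊆ Γ (⊆remove-insert ρ x) ρ-x∈lk)) ,
    ℕ.≤-trans (p⊆q⇒∣p∣≤∣q∣ (remove⊆ ρ x)) small

  link-supported : ∀ (Γ : Complex n) x {z : Chain n} →
    Supported (face Γ) (suc k) z → Supported (face (lk Γ x)) k (link x z)
  link-supported Γ x {z} z-supp σ ¬lk with x ∈? σ
  ... | yes x∈σ = reflexive (∂-summand-∈ z x∈σ)
  ... | no  x∉σ = trans (reflexive (∂-summand-∉ z x∉σ)) (trans (*-congˡ (z-supp _ ¬face)) (zeroʳ _))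
    where
    ¬face : ¬ (face Γ (σ ∪ ⁅ x ⁆) × ∣ σ ∪ ⁅ x ⁆ ∣ ≡ suc _)
    ¬face (σx∈Γ , size) = ¬lk ((σx∈Γ , x∉σ) , ℕ.suc-injective (≡.trans (≡.sym (∣insert∣ σ x x∉σ)) size))

  link-cycle : ∀ x {z : Chain n} → Cycle z → Cycle (link x z)
  link-cycle x {z} z-cycle τ = trans (∂-link x z τ) (-‿vanishes (link-vanishes x z-cycle τ))

  -- If the link chain of z bounds b in lk Γ x, then z + ∂ (cone x b) is a cycle of del Γ x
  -- homologous to z.
  module LinkBoundary (Γ : Complex n) (x : Fin n) {z b : Chain n}
    (z-supp : Supported (face Γ) (suc k) z)
    (b-supp : Supported (face (lk Γ x)) (suc k) b)
    (∂b≈ : ∀ σ → ∂ b σ ≈ link x z σ) where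

    w : Chain n
    w σ = z σ + ∂ (cone x b) σ

    cone-b-supported : Supported (face Γ) (suc (suc k)) (cone x b)
    cone-b-supported = cone-supported x (λ _ (τx∈Γ , _) → τx∈Γ) b-supp

    w-supported : Supported (face (del Γ x)) (suc k) w
    w-supported σ ¬del with x ∈? σ
    ... | yes x∈σ = begin
      z σ + ∂ (cone x b) σ                        ≈⟨ +-comm _ _ ⟩
      ∂ (cone x b) σ + z σ                        ≈⟨ +-congˡ (trans (cone-cong x ∂b≈ σ) (cone-link x z x∈σ)) ⟨
      ∂ (cone x b) σ + cone x (∂ b) σ             ≈⟨ cone-homotopy x b σ ⟩
      b σ                                         ≈⟨ b-supp σ (λ ((_ , x∉σ) , _) → x∉σ x∈σ) ⟩
      0#                                          ∎
    ... | no  x∉σ = begin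
      z σ + ∂ (cone x b) σ                        ≈⟨ +-cong zσ≈0 ∂cone≈b ⟩
      0# + b σ                                    ≈⟨ +-identityˡ _ ⟩
      b σ                                         ≈⟨ b-supp σ (λ ((σx∈Γ , _) , size) → ¬σ∈ (face-⊆ Γ (p⊆p∪q ⁅ x ⁆) σx∈Γ) size) ⟩
      0#                                          ∎
      where
      ¬σ∈ : face Γ σ → ∣ σ ∣ ≢ suc k
      ¬σ∈ σ∈Γ size = ¬del ((σ∈Γ , x∉σ) , size)

      zσ≈0 : z σ ≈ 0#
      zσ≈0 = z-supp σ (λ (σ∈Γ , size) → ¬σ∈ σ∈Γ size)

      ∂cone≈b : ∂ (cone x b) σ ≈ b σ
      ∂cone≈b = begin
        ∂ (cone x b) σ                     ≈⟨ +-identityʳ _ ⟨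
        ∂ (cone x b) σ + 0#                ≡⟨ ≡.cong (∂ (cone x b) σ +_) (cone-∉ x (∂ b) x∉σ) ⟨
        ∂ (cone x b) σ + cone x (∂ b) σ    ≈⟨ cone-homotopy x b σ ⟩
        b σ                                ∎

    w-cycle : Cycle z → Cycle w
    w-cycle z-cycle τ = begin
      ∂ w τ                                ≈⟨ ∂-+ z (∂ (cone x b)) τ ⟩
      ∂ z τ + ∂ (∂ (cone x b)) τ           ≈⟨ +-cong (z-cycle τ) (∂∘∂≈0 (cone x b) τ) ⟩
      0# + 0#                              ≈⟨ +-identityˡ 0# ⟩
      0#                                   ∎

    z-isBoundary : IsBoundary (del Γ x) (suc k) w → IsBoundary Γ (suc k) z
    z-isBoundary (d , d-supp , ∂d≈w) =
      (λ σ → d σ + - cone x b σ) ,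
      Supported-+ (Supported-mono proj₁ d-supp) (Supported-neg cone-b-supported) ,
      λ σ → begin
        ∂ (λ σ → d σ + - cone x b σ) σ                  ≈⟨ ∂-+ d (λ σ → - cone x b σ) σ ⟩
        ∂ d σ + ∂ (λ σ → - cone x b σ) σ                ≈⟨ +-cong (∂d≈w σ) (∂-neg (cone x b) σ) ⟩
        (z σ + ∂ (cone x b) σ) + - ∂ (cone x b) σ      ≈⟨ +-assoc _ _ _ ⟩
        z σ + (∂ (cone x b) σ + - ∂ (cone x b) σ)      ≈⟨ +-congˡ (-‿inverseʳ _) ⟩
        z σ + 0#                                        ≈⟨ +-identityʳ _ ⟩
        z σ                                             ∎

  lk-homology : ∀ (Γ : Complex n) x → NontrivialHomology Γ (suc k) →
    ¬ NontrivialHomology (del Γ x) (suc k) → NontrivialHomology (lk Γ x) k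
  lk-homology Γ x (z , z-supp , z-cycle , ¬bd) ¬H-del =
    link x z , link-supported Γ x z-supp , link-cycle x {z} z-cycle ,
    λ (b , b-supp , ∂b≈) → let open LinkBoundary Γ x z-supp b-supp ∂b≈ in
      ¬H-del (w , w-supported , w-cycle z-cycle , λ bd → ¬bd (z-isBoundary bd))

  nonface-nonempty : ∀ (Γ : Complex n) → NontrivialHomology Γ k → ∀ {ρ} → ¬ face Γ ρ → Nonempty ρ
  nonface-nonempty Γ H {ρ} ρ∉Γ with ∣ ρ ∣ in ∣ρ∣≡
  ... | zero  = contradiction (≡.subst (face Γ) (≡.sym (∣p∣≡0⇒p≡⊥ ρ ∣ρ∣≡)) (nontrivial⇒∅∈Γ Γ H)) ρ∉Γ
  ... | suc _ = ∣p∣>0⇒nonempty ρ (≡.subst (0 <_) (≡.sym ∣ρ∣≡) (s≤s z≤n))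

module SizeBound {c ℓ : Level} (K : Field c ℓ) where
  open import Data.Nat using (zero; _+_; _*_; _<_; _≤?_; z≤n)
  import Data.Nat.Properties as ℕ
  open import Data.Nat.Properties using (≤-trans; ≤-reflexive; +-monoʳ-≤; +-identityʳ; *-zeroʳ)
  open import Data.Bool using (false)
  open import Data.Fin.Subset using (_⊆_)
  open import Data.Fin.Subset.Properties using (⊆-refl)
  open import Data.Vec using (_[_]≔_)
  open import Data.Product using (_,_; proj₁; proj₂)
  open import Relation.Nullary using (¬_)
  open import Relation.Nullary.Decidable using (decidable-stable)
  open import Relation.Nullary.Negation using (contradiction)
  open import Relation.Binary.PropositionalEquality as ≡ using (_≡_)
  open Arithmetic
  open ReducedHomology K
  open HomologyOfComplexes K

  private variable n k : ℕ

  nonface-bound : ∀ t m (Γ : Complex n) → ∣ ground Γ ∣ ≡ m → GeneratedInDegree≤ (suc t) Γ →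
    NontrivialHomology Γ k → ∀ {ρ} → ρ ⊆ ground Γ → ¬ face Γ ρ → suc t * suc k ≤ t * m + ∣ ρ ∣
  nonface-bound t zero Γ ∣V∣≡0 gen H ρ⊆V ρ∉Γ =
    contradiction (≡.subst (0 <_) ∣V∣≡0 (x∈p⇒∣p∣>0 (ρ⊆V (proj₂ (nonface-nonempty Γ H ρ∉Γ))))) ℕ.n≮0
  nonface-bound {k = zero} t (suc m) Γ _ gen H ρ⊆V ρ∉Γ =
    ≤-trans (add-vertex t m 0 0 (≤-trans (≤-reflexive (*-zeroʳ (suc t))) z≤n))
            (+-monoʳ-≤ (t * suc m) (x∈p⇒∣p∣>0 (proj₂ (nonface-nonempty Γ H ρ∉Γ))))
  nonface-bound {k = suc k} t (suc m) Γ ∣V∣≡ gen H {ρ} ρ⊆V ρ∉Γ =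
    -- a classical case split on whether del Γ x keeps the homology; sound because the goal is decidable
    decidable-stable (_ ≤? _) λ ¬bound → ¬bound (via-lk λ H-del → ¬bound (via-del H-del))
    where
    x = proj₁ (nonface-nonempty Γ H ρ∉Γ)
    x∈ρ = proj₂ (nonface-nonempty Γ H ρ∉Γ)
    x∈V = ρ⊆V x∈ρ
    ∣V-x∣≡m : ∣ ground Γ [ x ]≔ false ∣ ≡ m
    ∣V-x∣≡m = ℕ.suc-injective (≡.trans (∣remove∣ (ground Γ) x x∈V) ∣V∣≡)

    via-del : NontrivialHomology (del Γ x) (suc k) → suc t * suc (suc k) ≤ t * suc m + ∣ ρ ∣
    via-del H-del with gen-del ← del-generated Γ x gen
                  with ρ′ , ρ′⊆ , ρ′∉ , small ← gen-del _ ⊆-refl (ground-nonface (del Γ x) H-del) =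
      ≤-trans (add-vertex t m (suc k) 0 (≤-trans
                 (drop-small-summand t m k _ (nonface-bound t m (del Γ x) ∣V-x∣≡m gen-del H-del ρ′⊆ ρ′∉) small)
                 (≤-reflexive (≡.sym (+-identityʳ (t * m))))))
              (+-monoʳ-≤ (t * suc m) (x∈p⇒∣p∣>0 x∈ρ))

    via-lk : ¬ NontrivialHomology (del Γ x) (suc k) → suc t * suc (suc k) ≤ t * suc m + ∣ ρ ∣
    via-lk ¬H-del = ≡.subst (λ r → suc t * suc (suc k) ≤ t * suc m + r) (∣remove∣ ρ x x∈ρ)
      (add-vertex t m (suc k) _
        (nonface-bound t m (lk Γ x) ∣V-x∣≡m (lk-generated Γ x∈V gen) (lk-homology Γ x H ¬H-del)
           (remove-mono ρ⊆V) (λ (ρ∈Γ , _) → ρ∉Γ (≡.subst (face Γ) (remove-insert ρ x x∈ρ) ρ∈Γ))))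

  homology-bound : ∀ t (Γ : Complex n) → GeneratedInDegree≤ (suc t) Γ → NontrivialHomology Γ k →
    suc t * k ≤ t * ∣ ground Γ ∣
  homology-bound {k = zero}  t Γ gen H = ≤-trans (≤-reflexive (*-zeroʳ (suc t))) z≤n
  homology-bound {k = suc k} t Γ gen H with ρ , ρ⊆V , ρ∉Γ , small ← gen _ ⊆-refl (ground-nonface Γ H) =
    drop-small-summand t _ k _ (nonface-bound t _ Γ ≡.refl gen H ρ⊆V ρ∉Γ) small

module InducedSubcomplexes where
  open import Data.Nat using (zero; _<_; z≤n; s≤s)
  open import Data.Nat.Properties using (suc-injective)
  open import Data.Bool using (false)
  open import Data.Fin.Properties using (any?)
  open import Data.Fin.Subset using (_⊆_; _∪_; ⁅_⁆; ⊥)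
  open import Data.Fin.Subset.Properties using (⊆-trans; ⊆-refl; ⊆-min; _∈?_; _⊆?_; ∪-identityˡ)
  open import Data.Vec using (_[_]≔_)
  open import Data.Product using (∃; _×_; _,_; proj₁; proj₂)
  open import Relation.Nullary using (¬_; yes; no)
  open import Relation.Nullary.Decidable using (T?; _×-dec_; ¬?)
  open import Relation.Nullary.Negation using (contradiction)
  open import Relation.Binary.PropositionalEquality using (_≡_; refl; sym; trans; cong; subst)

  private variable n : ℕ

  restriction : SimplicialComplex n → Subset n → Complex n
  restriction Δ W = record
    { face        = FaceOfRestriction Δ W
    ; face?       = λ σ → T? (isFace Δ σ) ×-dec (σ ⊆? W)
    ; face-⊆      = λ {σ} {τ} τ⊆σ (σ∈Δ , σ⊆W) → downward Δ σ τ τ⊆σ σ∈Δ , ⊆-trans τ⊆σ σ⊆W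
    ; ground      = W
    ; face⊆ground = proj₂
    }

  module _ (Δ : SimplicialComplex n) where

    minimal-nonface-⊆ : ∀ m σ → ∣ σ ∣ ≡ m → ¬ Face Δ σ → ∃ λ ρ → ρ ⊆ σ × IsMinimalNonFace Δ ρ
    minimal-nonface-⊆ m σ ∣σ∣≡m σ∉Δ with any? (λ i → i ∈? σ ×-dec ¬? (T? (isFace Δ (σ [ i ]≔ false))))
    ... | no ¬smaller = σ , ⊆-refl , σ∉Δ , facets-are-faces
      where
      facets-are-faces : ∀ i → i ∈ σ → Face Δ (σ [ i ]≔ false)
      facets-are-faces i i∈σ with T? (isFace Δ (σ [ i ]≔ false))
      ... | yes σ-i∈Δ = σ-i∈Δ
      ... | no  σ-i∉Δ = contradiction (i , i∈σ , σ-i∉Δ) ¬smaller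
    minimal-nonface-⊆ zero    σ ∣σ∣≡0 σ∉Δ | yes (i , i∈σ , _) with () ← trans (∣remove∣ σ i i∈σ) ∣σ∣≡0
    minimal-nonface-⊆ (suc m) σ ∣σ∣≡m σ∉Δ | yes (i , i∈σ , σ-i∉Δ)
      with ρ , ρ⊆ , ρ-min ← minimal-nonface-⊆ m (σ [ i ]≔ false) (suc-injective (trans (∣remove∣ σ i i∈σ) ∣σ∣≡m)) σ-i∉Δ
      = ρ , ⊆-trans ρ⊆ (remove⊆ σ i) , ρ-min

    restriction-generated : ∀ {s} → (∀ σ → IsMinimalNonFace Δ σ → ∣ σ ∣ ≤ s) → ∀ W →
      GeneratedInDegree≤ s (restriction Δ W)
    restriction-generated max-size W σ σ⊆W ¬σ∈Δ|W
      with ρ , ρ⊆σ , ρ-min ← minimal-nonface-⊆ _ σ refl (λ σ∈Δ → ¬σ∈Δ|W (σ∈Δ , σ⊆W))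
      = ρ , ρ⊆σ , (λ (ρ∈Δ , _) → proj₁ ρ-min ρ∈Δ) , max-size ρ ρ-min

  nonface-size≥2 : ∀ (Δ : SimplicialComplex (suc n)) σ → ¬ Face Δ σ → 2 ≤ ∣ σ ∣
  nonface-size≥2 Δ σ σ∉Δ with ∣ σ ∣ in ∣σ∣≡
  ... | zero = contradiction (subst (Face Δ) (sym (∣p∣≡0⇒p≡⊥ σ ∣σ∣≡)) ∅∈Δ) σ∉Δ
    where ∅∈Δ = downward Δ ⁅ Fin.zero ⁆ ⊥ (⊆-min ⁅ Fin.zero ⁆) (vertices Δ Fin.zero)
  ... | suc zero with x , x∈σ ← ∣p∣>0⇒nonempty σ (subst (0 <_) (sym ∣σ∣≡) (s≤s z≤n)) =
    contradiction (downward Δ ⁅ x ⁆ σ σ⊆⁅x⁆ (vertices Δ x)) σ∉Δ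
    where
    σ-x≡⊥ = ∣p∣≡0⇒p≡⊥ _ (suc-injective (trans (∣remove∣ σ x x∈σ) ∣σ∣≡))
    σ⊆⁅x⁆ : σ ⊆ ⁅ x ⁆
    σ⊆⁅x⁆ = subst (σ ⊆_) (trans (cong (_∪ ⁅ x ⁆) σ-x≡⊥) (∪-identityˡ ⁅ x ⁆)) (⊆remove-insert σ x)
  ... | suc (suc _) = s≤s (s≤s z≤n)

  max-degree≥2 : ∀ (Δ : SimplicialComplex (suc n)) {s} → IsMaxGeneratorDegree Δ s → 2 ≤ s
  max-degree≥2 Δ ((σ , σ-min , ∣σ∣≡s) , _) = subst (2 ≤_) ∣σ∣≡s (nonface-size≥2 Δ σ (proj₁ σ-min))

open InducedSubcomplexes

module Reachability {n} (Δ : SimplicialComplex n) (S : Subset n) (u : Fin n) (u∉S : u ∉ S) where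
  open import Data.Nat using (zero; _+_)
  open import Data.Nat.Properties using (≤-trans; ≤-reflexive; m≤m+n; <-irrefl; +-suc)
  open import Data.Fin.Properties using (_≟_; any?)
  open import Data.Fin.Subset using (_∪_; ⁅_⁆)
  open import Data.Fin.Subset.Properties using (p⊆p∪q; _∈?_; ∣p∣≤n; x∈⁅x⁆; x∈⁅y⁆⇒x≡y)
  open import Data.Product using (∃; _×_; _,_)
  open import Relation.Nullary using (Dec; yes; no)
  open import Relation.Nullary.Decidable using (T?; _×-dec_; ¬?)
  open import Relation.Nullary.Negation using (contradiction)
  open import Relation.Binary.PropositionalEquality using (refl; sym; trans; cong; subst)

  walk-snoc : ∀ {a b} → WalkAvoiding Δ S u a → Adjacent Δ a b → b ∉ S → WalkAvoiding Δ S u b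
  walk-snoc = go
    where
    go : ∀ {x a b} → WalkAvoiding Δ S x a → Adjacent Δ a b → b ∉ S → WalkAvoiding Δ S x b
    go stop           a~b b∉S = step a~b b∉S stop
    go (step c~d d∉S w) a~b b∉S = step c~d d∉S (go w a~b b∉S)

  adjacent? : ∀ a b → Dec (Adjacent Δ a b)
  adjacent? a b = ¬? (a ≟ b) ×-dec T? (isFace Δ (⁅ a ⁆ ∪ ⁅ b ⁆))

  record Reached (A : Subset n) : Set where
    field
      walk   : ∀ {x} → x ∈ A → WalkAvoiding Δ S u x
      avoids : ∀ {x} → x ∈ A → x ∉ S
      start  : u ∈ A

  Closed : Subset n → Set
  Closed A = ∀ {a b} → a ∈ A → b ∉ S → Adjacent Δ a b → b ∈ A

  ReachableComponent : Set
  ReachableComponent = ∃ λ A → Reached A × Closed A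

  -- fuel bounds the number of growth steps by n − ∣ A ∣
  grow : ∀ fuel A → n ≤ fuel + ∣ A ∣ → Reached A → ReachableComponent
  grow fuel A bound reached
    with any? (λ b → ¬? (b ∈? A) ×-dec (¬? (b ∈? S) ×-dec any? (λ a → a ∈? A ×-dec adjacent? a b)))
  ... | no ¬exit = A , reached , closed
    where
    closed : Closed A
    closed {a} {b} a∈A b∉S a~b with b ∈? A
    ... | yes b∈A = b∈A
    ... | no  b∉A = contradiction (b , b∉A , b∉S , a , a∈A , a~b) ¬exit
  ... | yes (b , b∉A , b∉S , a , a∈A , a~b) = continue fuel bound
    where
    open Reached reached
    A′ = A ∪ ⁅ b ⁆

    reached′ : Reached A′
    reached′ = record { walk = walk′ ; avoids = avoids′ ; start = p⊆p∪q ⁅ b ⁆ start }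
      where
      walk′ : ∀ {x} → x ∈ A′ → WalkAvoiding Δ S u x
      walk′ {x} x∈A′ with x ≟ b
      ... | yes refl = walk-snoc (walk a∈A) a~b b∉S
      ... | no  x≢b  = walk (∈-insert⁻ x∈A′ x≢b)
      avoids′ : ∀ {x} → x ∈ A′ → x ∉ S
      avoids′ {x} x∈A′ with x ≟ b
      ... | yes refl = b∉S
      ... | no  x≢b  = avoids (∈-insert⁻ x∈A′ x≢b)

    continue : ∀ fuel → n ≤ fuel + ∣ A ∣ → ReachableComponent
    continue zero     bound =
      contradiction (≤-trans (≤-reflexive (sym (∣insert∣ A b b∉A))) (≤-trans (∣p∣≤n A′) bound)) (<-irrefl refl)
    continue (suc fuel) bound =
      grow fuel A′ (subst (n ≤_) (trans (sym (+-suc fuel ∣ A ∣)) (cong (fuel +_) (sym (∣insert∣ A b b∉A)))) bound)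
           reached′

  reachable-component : ReachableComponent
  reachable-component = grow n ⁅ u ⁆ (m≤m+n n _) record
    { walk   = λ x∈⁅u⁆ → subst (WalkAvoiding Δ S u) (sym (x∈⁅y⁆⇒x≡y u x∈⁅u⁆)) stop
    ; avoids = λ x∈⁅u⁆ → subst (_∉ S) (sym (x∈⁅y⁆⇒x≡y u x∈⁅u⁆)) u∉S
    ; start  = x∈⁅x⁆ u
    }

-- If A is a union of components of the 1-skeleton with S deleted, and neither A nor the
-- rest exhausts [n] ∖ S, then the fundamental cycle z splits as zA + zB (simplices meeting A
-- or not), and ∂ zA is a cycle of Δ|_S; were it a boundary ∂ e there, zA − e and zB + e would
-- be cycles on the proper subsets A ∪ S and ∁ A, hence boundaries by minimality, and so would z.
module Separation {n} {ℓ₁ ℓ₂ : Level} (Δ : SimplicialComplex n) (K : Field ℓ₁ ℓ₂) (h : ℕ)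
  (minimal : IsVertexMinimalCycle K Δ h) (S A : Subset n)
  (A-avoids-S : ∀ {x} → x ∈ A → x ∉ S)
  (A-closed : ∀ {a b} → a ∈ A → b ∉ S → Adjacent Δ a b → b ∈ A)
  {u v : Fin n} (u∈A : u ∈ A) (v∉A : v ∉ A) (v∉S : v ∉ S) where
  import Data.Nat.Properties as ℕ
  open import Data.Fin.Properties using (_≟_; any?)
  open import Data.Fin.Subset using (_⊆_; _∪_; ⁅_⁆; ⊤; ∁)
  open import Data.Fin.Subset.Properties using (⊆-trans; p⊆p∪q; q⊆p∪q; x∈p∪q⁻; ⊆⊤; ∈⊤; x∉p⇒x∈∁p; x∈p⇒x∉∁p; _∈?_)
  open import Data.Product using (∃; _×_; _,_; proj₁; proj₂)
  open import Data.Sum using (inj₁; inj₂)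
  open import Relation.Nullary using (¬_; Dec; yes; no)
  open import Relation.Nullary.Decidable using (_×-dec_)
  open import Relation.Nullary.Negation using (contradiction)
  open import Relation.Binary.PropositionalEquality as ≡ using (_≢_)
  open Field K hiding (zero)
  open Homology K using (Chain; ∂)
  open ChainAlgebra K
  open ReducedHomology K
  open HomologyOfComplexes K
  open import Relation.Binary.Reasoning.Setoid setoid

  Meets : Subset n → Set
  Meets σ = ∃ λ a → a ∈ σ × a ∈ A

  meets? : ∀ σ → Dec (Meets σ)
  meets? σ = any? (λ a → a ∈? σ ×-dec a ∈? A)

  face-meeting-A : ∀ {σ} → Face Δ σ → Meets σ → ∀ {i} → i ∈ σ → i ∉ S → i ∈ A
  face-meeting-A {σ} σ∈Δ (a , a∈σ , a∈A) {i} i∈σ i∉S with i ≟ a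
  ... | yes ≡.refl = a∈A
  ... | no  i≢a    = A-closed a∈A i∉S (≡.≢-sym i≢a , downward Δ σ _ (insert⊆ (x∈p⇒⁅x⁆⊆p a∈σ) i∈σ) σ∈Δ)

  face-meeting-A⊆A∪S : ∀ {σ} → Face Δ σ → Meets σ → σ ⊆ A ∪ S
  face-meeting-A⊆A∪S σ∈Δ meets {i} i∈σ with i ∈? S
  ... | yes i∈S = q⊆p∪q A S i∈S
  ... | no  i∉S = p⊆p∪q S (face-meeting-A σ∈Δ meets i∈σ i∉S)

  missing-A⊆∁A : ∀ {σ} → ¬ Meets σ → σ ⊆ ∁ A
  missing-A⊆∁A misses {i} i∈σ with i ∈? A
  ... | yes i∈A = contradiction (i , i∈σ , i∈A) misses
  ... | no  i∉A = x∉p⇒x∈∁p i∉A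

  S⊆∁A : S ⊆ ∁ A
  S⊆∁A {i} i∈S with i ∈? A
  ... | yes i∈A = contradiction i∈S (A-avoids-S i∈A)
  ... | no  i∉A = x∉p⇒x∈∁p i∉A

  proper-acyclic : ∀ {W} → W ≢ ⊤ → ¬ NontrivialHomology (restriction Δ W) (suc h)
  proper-acyclic W≢⊤ H = W≢⊤ (proj₁ (minimal _) H)

  A∪S≢⊤ : A ∪ S ≢ ⊤
  A∪S≢⊤ A∪S≡⊤ with x∈p∪q⁻ A S (≡.subst (v ∈_) (≡.sym A∪S≡⊤) ∈⊤)
  ... | inj₁ v∈A = v∉A v∈A
  ... | inj₂ v∈S = v∉S v∈S

  ∁A≢⊤ : ∁ A ≢ ⊤
  ∁A≢⊤ ∁A≡⊤ = x∈p⇒x∉∁p u∈A (≡.subst (u ∈_) (≡.sym ∁A≡⊤) ∈⊤)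

  restriction-mono : ∀ {W W′ k} {y : Chain n} → W ⊆ W′ →
    Supported (face (restriction Δ W)) k y → Supported (face (restriction Δ W′)) k y
  restriction-mono W⊆W′ = Supported-mono (λ (σ∈Δ , σ⊆W) → σ∈Δ , ⊆-trans σ⊆W W⊆W′)

  fundamental : NontrivialHomology (restriction Δ ⊤) (suc h)
  fundamental = proj₂ (minimal ⊤) ≡.refl

  z : Chain n
  z = proj₁ fundamental

  z-supported : Supported (FaceOfRestriction Δ ⊤) (suc h) z
  z-supported = proj₁ (proj₂ fundamental)

  z-cycle : Cycle z
  z-cycle = proj₁ (proj₂ (proj₂ fundamental))

  zA zB : Chain n
  zA σ with meets? σ
  ... | yes _ = z σ
  ... | no  _ = 0#
  zB σ with meets? σ
  ... | yes _ = 0#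
  ... | no  _ = z σ

  z≈zA+zB : ∀ σ → z σ ≈ zA σ + zB σ
  z≈zA+zB σ with meets? σ
  ... | yes _ = sym (+-identityʳ (z σ))
  ... | no  _ = sym (+-identityˡ (z σ))

  zA-supported : Supported (face (restriction Δ (A ∪ S))) (suc h) zA
  zA-supported σ ¬σ∈ with meets? σ
  ... | yes meets = z-supported σ (λ ((σ∈Δ , _) , size) → ¬σ∈ ((σ∈Δ , face-meeting-A⊆A∪S σ∈Δ meets) , size))
  ... | no  _     = refl

  zB-supported : Supported (face (restriction Δ (∁ A))) (suc h) zB
  zB-supported σ ¬σ∈ with meets? σ
  ... | yes _      = refl
  ... | no  misses = z-supported σ (λ ((σ∈Δ , _) , size) → ¬σ∈ ((σ∈Δ , missing-A⊆∁A misses) , size))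

  c : Chain n
  c = ∂ zA

  c-supported : Supported (face (restriction Δ S)) h c
  c-supported τ ¬τ∈ with meets? τ
  ... | yes meets = trans (∂-local zA z τ zA≈z) (z-cycle τ)
    where
    zA≈z : ∀ w → w ∉ τ → zA (τ ∪ ⁅ w ⁆) ≈ z (τ ∪ ⁅ w ⁆)
    zA≈z w _ with meets? (τ ∪ ⁅ w ⁆)
    ... | yes _      = refl
    ... | no  misses = contradiction (let a , a∈τ , a∈A = meets in a , p⊆p∪q ⁅ w ⁆ a∈τ , a∈A) misses
  ... | no  misses = trans (∂-local zA (λ _ → 0#) τ zA≈0) (∂-zero (λ _ → 0#) (λ _ → refl) τ)
    where
    zA≈0 : ∀ w → w ∉ τ → zA (τ ∪ ⁅ w ⁆) ≈ 0#
    zA≈0 w w∉τ with meets? (τ ∪ ⁅ w ⁆)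
    ... | no  _     = refl
    ... | yes meets = z-supported _ λ ((τw∈Δ , _) , size) →
      ¬τ∈ ( (downward Δ _ τ (p⊆p∪q ⁅ w ⁆) τw∈Δ , τ⊆S τw∈Δ meets)
          , ℕ.suc-injective (≡.trans (≡.sym (∣insert∣ τ w w∉τ)) size))
      where
      τ⊆S : Face Δ (τ ∪ ⁅ w ⁆) → Meets (τ ∪ ⁅ w ⁆) → τ ⊆ S
      τ⊆S τw∈Δ meets {i} i∈τ with i ∈? S
      ... | yes i∈S = i∈S
      ... | no  i∉S = contradiction (i , i∈τ , face-meeting-A τw∈Δ meets (p⊆p∪q ⁅ w ⁆ i∈τ) i∉S) misses

  c-not-boundary : ¬ IsBoundary (restriction Δ S) h c
  c-not-boundary (e , e-supp , ∂e≈c) =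
    proper-acyclic A∪S≢⊤ (z₁ , z₁-supported , z₁-cycle , λ bd₁ →
    proper-acyclic ∁A≢⊤  (z₂ , z₂-supported , z₂-cycle , λ bd₂ →
    proj₂ (proj₂ (proj₂ fundamental))
      (IsBoundary-≈ {Γ = Δ|⊤} z₁+z₂≈z (IsBoundary-+ {Γ = Δ|⊤}
         (IsBoundary-mono {Γ = restriction Δ (A ∪ S)} {Δ|⊤} widen bd₁)
         (IsBoundary-mono {Γ = restriction Δ (∁ A)} {Δ|⊤} widen bd₂)))))
    where
    z₁ z₂ : Chain n
    z₁ σ = zA σ + - e σ
    z₂ σ = zB σ + e σ

    z₁-supported : Supported (face (restriction Δ (A ∪ S))) (suc h) z₁
    z₁-supported = Supported-+ zA-supported (Supported-neg (restriction-mono (q⊆p∪q A S) e-supp))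

    z₂-supported : Supported (face (restriction Δ (∁ A))) (suc h) z₂
    z₂-supported = Supported-+ zB-supported (restriction-mono S⊆∁A e-supp)

    z₁-cycle : Cycle z₁
    z₁-cycle τ = begin
      ∂ z₁ τ                            ≈⟨ ∂-+ zA (λ σ → - e σ) τ ⟩
      ∂ zA τ + ∂ (λ σ → - e σ) τ        ≈⟨ +-congˡ (trans (∂-neg e τ) (-‿cong (∂e≈c τ))) ⟩
      c τ + - c τ                       ≈⟨ -‿inverseʳ (c τ) ⟩
      0#                                ∎

    z₂-cycle : Cycle z₂
    z₂-cycle τ = begin
      ∂ z₂ τ                            ≈⟨ ∂-+ zB e τ ⟩
      ∂ zB τ + ∂ e τ                    ≈⟨ trans (+-congˡ (∂e≈c τ)) (+-comm _ _) ⟩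
      ∂ zA τ + ∂ zB τ                   ≈⟨ ∂-+ zA zB τ ⟨
      ∂ (λ σ → zA σ + zB σ) τ           ≈⟨ ∂-cong z≈zA+zB τ ⟨
      ∂ z τ                             ≈⟨ z-cycle τ ⟩
      0#                                ∎

    z₁+z₂≈z : ∀ σ → z₁ σ + z₂ σ ≈ z σ
    z₁+z₂≈z σ = begin
      (zA σ + - e σ) + (zB σ + e σ)     ≈⟨ interchange _ _ _ _ ⟩
      (zA σ + zB σ) + (- e σ + e σ)     ≈⟨ +-congˡ (-‿inverseˡ (e σ)) ⟩
      (zA σ + zB σ) + 0#                ≈⟨ +-identityʳ _ ⟩
      zA σ + zB σ                       ≈⟨ z≈zA+zB σ ⟨
      z σ                               ∎
      where open import Algebra.Properties.CommutativeSemigroup +-commutativeSemigroup using (interchange)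

    Δ|⊤ = restriction Δ ⊤

    widen : ∀ {W σ} → FaceOfRestriction Δ W σ → FaceOfRestriction Δ ⊤ σ
    widen (σ∈Δ , _) = σ∈Δ , ⊆⊤

  separator-homology : NontrivialHomology (restriction Δ S) h
  separator-homology = c , c-supported , ∂∘∂≈0 zA , c-not-boundary

module Connectivity {n} {ℓ₁ ℓ₂ : Level} (Δ : SimplicialComplex n) (K : Field ℓ₁ ℓ₂) (h : ℕ)
  (minimal : IsVertexMinimalCycle K Δ h) (t : ℕ)
  (max-size : ∀ σ → IsMinimalNonFace Δ σ → ∣ σ ∣ ≤ suc t) where
  open import Data.Nat using (_*_)
  open import Data.Fin.Subset using (⊤)
  open import Data.Fin.Subset.Properties using (∣⊤∣≡n; _∈?_)
  open import Data.Product using (_,_; proj₂)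
  open import Data.Sum using (_⊎_; inj₁; inj₂)
  open import Relation.Nullary using (yes; no)
  open import Relation.Binary.PropositionalEquality using (refl; subst)
  open SizeBound K

  vertex-bound : suc t * suc h ≤ t * n
  vertex-bound = subst (λ m → suc t * suc h ≤ t * m) (∣⊤∣≡n n)
    (homology-bound t (restriction Δ ⊤) (restriction-generated Δ max-size ⊤) (proj₂ (minimal ⊤) refl))

  connected-or-separator-large : ∀ S {u v} → u ∉ S → v ∉ S → WalkAvoiding Δ S u v ⊎ suc t * h ≤ t * ∣ S ∣
  connected-or-separator-large S {u} {v} u∉S v∉S
    with A , reached , closed ← Reachability.reachable-component Δ S u u∉S
    with v ∈? A
  ... | yes v∈A = inj₁ (walk v∈A)
    where open Reachability.Reached reached
  ... | no  v∉A = inj₂ (homology-bound t (restriction Δ S) (restriction-generated Δ max-size S)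
                         (Separation.separator-homology Δ K h minimal S A avoids closed start v∉A v∉S))
    where open Reachability.Reached reached

open import Level using (0ℓ)
open import Data.Nat using (ℕ; zero; suc; _*_; _∸_; _<_; s≤s)
open import Data.Nat.Properties using (<-≤-trans; <-irrefl)
open import Data.Fin.Subset using (⊤)
open import Data.Product using (_,_; proj₂)
open import Data.Sum using (inj₁; inj₂)
open import Data.Empty using (⊥-elim)
open import Relation.Nullary.Negation using (contradiction)
open import Relation.Binary.PropositionalEquality using (refl)
open Arithmetic

corollary4p1 : (n h : ℕ) (Δ : SimplicialComplex n) (K : Field 0ℓ 0ℓ) →
    IsVertexMinimalCycle K Δ h →
    (s : ℕ) → IsMaxGeneratorDegree Δ s →
    IsMConnectedSkeleton Δ ⌈ s * h / s ∸ 1 ⌉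
corollary4p1 zero h Δ K minimal s _ = ⊥-elim (ground-nonface Δ|⊤ H (nontrivial⇒∅∈Γ Δ|⊤ H))
  -- on no vertices ⊥ and ⊤ coincide
  where
  open HomologyOfComplexes K

  Δ|⊤ = restriction Δ ⊤
  H = proj₂ (minimal ⊤) refl
corollary4p1 (suc n) h Δ K minimal 0 deg = contradiction (max-degree≥2 Δ deg) λ ()
corollary4p1 (suc n) h Δ K minimal 1 deg = contradiction (max-degree≥2 Δ deg) λ { (s≤s ()) }
corollary4p1 (suc n) h Δ K minimal (suc (suc t)) (_ , max-size) = more-vertices , separators-large
  where
  open Connectivity Δ K h minimal (suc t) max-size

  more-vertices : ⌈ suc (suc t) * h / suc t ⌉ < suc n
  more-vertices = ⌈/⌉-< t h (suc n) vertex-bound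
  separators-large : ∀ S → ∣ S ∣ < ⌈ suc (suc t) * h / suc t ⌉ → ∀ u v → u ∉ S → v ∉ S → WalkAvoiding Δ S u v
  separators-large S small u v u∉S v∉S with connected-or-separator-large S u∉S v∉S
  ... | inj₁ walk  = walk
  ... | inj₂ large = contradiction (<-≤-trans small (⌈/⌉-≤ _ t ∣ S ∣ large)) (<-irrefl refl)
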